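{- Let $G$ be a connected graph, $v\in V(G)$, and let $k\geq 1$ be an integer. Let $S_{k+2}$ be the star with center $c$ and $k+1$ leaves, one of which is $u$. Let $H$ be the graph obtained from $G$ and $S_{k+2}$ (vertex-disjoint) by identifying $v$ with the leaf $u$, and let $K$ be the graph obtained from $G$ and $S_{k+2}$ by identifying $v$ with the center $c$. Let $r$ be the degree of $v$ in $\overline{G}$. If $r\geq 2$, then $$\eta(K)+\eta(\overline{K})-\big(\eta(H)+\eta(\overline{H})\big)>0.$$
   Context: $\overline{X}$ is the complement of a graph $X$. $\eta(X)$ is the number of nonempty vertex subsets $S\subseteq V(X)$ such that the induced subgraph on $S$ is connected. -}

module Defs where

open import Data.Bool using (Bool; true; false; _∧_; _∨_; not; if_then_else_; T)
open import Data.Nat using (ℕ; zero; suc; _+_)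
open import Data.Fin using (Fin; zero; suc; splitAt; _≟_)
open import Data.Sum using (_⊎_; inj₁; inj₂)
open import Data.Vec using (Vec; []; _∷_; lookup)
open import Data.List using (List; []; _∷_; map; _++_; allFin; filter; length)
open import Data.Bool.ListAction using (all; any)
open import Relation.Nullary.Decidable using (⌊_⌋)
open import Relation.Binary.PropositionalEquality using (_≡_)

-- A (simple) graph on the vertex set Fin n, given by a Bool-valued adjacency
-- relation.  Simplicity (symmetry, irreflexivity) is imposed as hypotheses.
Graph : ℕ → Set
Graph n = Fin n → Fin n → Bool

Symmetric : ∀ {n} → Graph n → Set
Symmetric {n} G = (x y : Fin n) → G x y ≡ G y x

Irreflexive : ∀ {n} → Graph n → Set
Irreflexive {n} G = (x : Fin n) → G x x ≡ false

_==_ : ∀ {n} → Fin n → Fin n → Bool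
x == y = ⌊ x ≟ y ⌋

complement : ∀ {n} → Graph n → Graph n
complement G x y = not (G x y) ∧ not (x == y)

Subset : ℕ → Set
Subset n = Vec Bool n

_∈ˢ_ : ∀ {n} → Fin n → Subset n → Bool
x ∈ˢ S = lookup S x

subsets : (n : ℕ) → List (Subset n)
subsets zero = [] ∷ []
subsets (suc n) = map (true ∷_) (subsets n) ++ map (false ∷_) (subsets n)

vertices : (n : ℕ) → List (Fin n)
vertices n = allFin n

nonemptyᵇ : ∀ {n} → Subset n → Bool
nonemptyᵇ {n} S = any (λ x → x ∈ˢ S) (vertices n)

degree : ∀ {n} → Graph n → Fin n → ℕ
degree {n} G v = length (filter (λ y → T? (G v y)) (vertices n))
  where
  open import Relation.Nullary using (Dec; yes; no)
  open import Data.Unit using (tt)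
  T? : (b : Bool) → Dec (T b)
  T? true = yes tt
  T? false = no (λ ())

-- The induced subgraph G[S] is connected (S nonempty): for every splitting of
-- S into two nonempty parts T and S∖T there is an edge of G between them.
connectedᵇ : ∀ {n} → Graph n → Subset n → Bool
connectedᵇ {n} G S = nonemptyᵇ S ∧ all cutOK (subsets n)
  where
  inT-not-S : Subset n → Bool
  inT-not-S Tt = any (λ x → x ∈ˢ Tt ∧ not (x ∈ˢ S)) (vertices n)
  inS-not-T : Subset n → Bool
  inS-not-T Tt = any (λ x → x ∈ˢ S ∧ not (x ∈ˢ Tt)) (vertices n)
  crossing : Subset n → Bool
  crossing Tt = any (λ x → any (λ y → x ∈ˢ Tt ∧ (y ∈ˢ S ∧ (not (y ∈ˢ Tt) ∧ G x y))) (vertices n)) (vertices n)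
  cutOK : Subset n → Bool
  cutOK Tt = if nonemptyᵇ Tt ∧ (not (inT-not-S Tt) ∧ inS-not-T Tt) then crossing Tt else true

full : (n : ℕ) → Subset n
full zero = []
full (suc n) = true ∷ full n

Connected : ∀ {n} → Graph n → Set
Connected {n} G = T (connectedᵇ G (full n))

η : ∀ {n} → Graph n → ℕ
η {n} G = length (filter (λ S → T? (connectedᵇ G S)) (subsets n))
  where
  open import Relation.Nullary using (Dec; yes; no)
  open import Data.Unit using (tt)
  T? : (b : Bool) → Dec (T b)
  T? true = yes tt
  T? false = no (λ ())

-- Vertex set of H and K: Fin (n + suc k) = V(G) ⊎ Fin (suc k) (via splitAt).
-- K: G with v identified with the centre of S_{k+2}; the k+1 leaves are
--    the extra vertices inj₂ i, each adjacent only to v.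
K-graph : ∀ {n} → Graph n → Fin n → (k : ℕ) → Graph (n + suc k)
K-graph {n} G v k x y with splitAt n x | splitAt n y
... | inj₁ a | inj₁ b = G a b
... | inj₁ a | inj₂ _ = a == v
... | inj₂ _ | inj₁ b = b == v
... | inj₂ _ | inj₂ _ = false

-- H: G with v identified with the leaf u of S_{k+2}; the extra vertices are
--    the centre c = inj₂ zero (adjacent to v) and the other k leaves
--    inj₂ (suc i), each adjacent only to c.
H-graph : ∀ {n} → Graph n → Fin n → (k : ℕ) → Graph (n + suc k)
H-graph {n} G v k x y with splitAt n x | splitAt n y
... | inj₁ a | inj₁ b = G a b
... | inj₁ a | inj₂ zero = a == v
... | inj₁ a | inj₂ (suc _) = false
... | inj₂ zero | inj₁ b = b == v
... | inj₂ (suc _) | inj₁ b = false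
... | inj₂ zero | inj₂ zero = false
... | inj₂ zero | inj₂ (suc _) = true
... | inj₂ (suc _) | inj₂ zero = true
... | inj₂ (suc _) | inj₂ (suc _) = false

-- Write a vertex set of H or K as A ∪ L, with A ⊆ V(G) and L a set of new vertices of the star.  On
-- each such set at least as many of K, K̄ as of H, H̄ are connected, except when L contains the centre c
-- and a leaf and {v} ⊊ A ⊆ N[v] (a loss set A), where the count may drop by one.  When L contains a leaf
-- but not c, and A ∋ v is connected in G and meets a non-neighbour of v (a gain set A), H is disconnected
-- while K and K̄ are connected, so the count rises by one.  Both situations occur for the same number of
-- sets L, so it suffices that gain sets outnumber loss sets.  As G is connected and v has two
-- non-neighbours, some edge u₁m₁ leads from N(v) to a non-neighbour m₁, and a second non-neighbour m₂ is
-- adjacent to u₁, to m₁ or to another neighbour u₂ of v.  A bijection of the subsets of V(G), composed of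
-- toggles of the coordinates u₁, m₁, m₂ (and u₂), maps every A with v ∈ A ⊆ N[v] to a gain set, and {v}
-- is not a loss set.
module Submission where

open import Defs
open import Data.Bool using (Bool; true; false; _∧_; _∨_; not; T; if_then_else_; _xor_)
open import Data.Bool.Properties using (T-∧; T-∨; T-≡; ∧-identityʳ; ¬-not)
open import Data.Bool.ListAction using (all; any)
open import Data.Empty using (⊥-elim)
open import Data.Fin using (Fin; zero; suc; _≟_; _↑ˡ_; _↑ʳ_; splitAt)
open import Data.Fin.Properties
  using (any?; splitAt-↑ˡ; splitAt-↑ʳ; splitAt⁻¹-↑ˡ; splitAt⁻¹-↑ʳ; ↑ˡ-injective; ↑ʳ-injective)
open import Data.Fin.Subset using (_∈_; _∉_; _⊆_; Nonempty; ⁅_⁆; _∩_; _─_; _-_) renaming (⊥ to ∅)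
open import Data.Fin.Subset.Properties
  using ( _∈?_; ∉⊥; nonempty?; x∈⁅x⁆; x∈⁅y⁆⇒x≡y; x≢y⇒x∉⁅y⁆; x∈p∩q⁺; x∈p∩q⁻; p∩q⊆q; p─q⊆p
        ; x∈p∧x≢y⇒x∈p-y)
open import Data.List as List using (List; []; _∷_; allFin; map; filter; length)
open import Data.List.Properties using (filter-++; length-++)
open import Data.List.Membership.Propositional using () renaming (_∈_ to _∈ₗ_)
open import Data.List.Membership.Propositional.Properties using (∈-++⁺ˡ; ∈-++⁺ʳ; ∈-map⁺)
open import Data.List.Relation.Unary.All as All using (All; []; _∷_)
open import Data.List.Relation.Unary.All.Properties using (all⁺; all⁻; all-filter)
open import Data.List.Relation.Unary.AllPairs using (_∷_)
import Data.List.Relation.Unary.Any as Any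
open import Data.List.Relation.Unary.Any.Properties using (any⁺; any⁻; tabulate⁺; tabulate⁻)
open import Data.List.Relation.Unary.Unique.Propositional using (Unique)
import Data.List.Relation.Unary.Unique.Propositional.Properties as Unique
open import Data.Nat using (ℕ; zero; suc; _+_; _*_; _<_; _≤_; _≥_; z≤n; s≤s; NonZero; >-nonZero)
open import Data.Nat.Properties
  using ( +-comm; *-comm; +-identityʳ; +-cancelˡ-<; +-monoˡ-<; *-monoˡ-<; *-distribʳ-+; +-mono-≤; +-mono-<-≤
        ; +-mono-≤-<; ≤-refl; ≤-reflexive; ≤-trans; m≤n+m; m≤m+n; +-commutativeSemigroup; module ≤-Reasoning)
open import Data.Product as Product using (∃; ∃₂; _×_; _,_; proj₁; proj₂)
open import Data.Sum as Sum using (_⊎_; inj₁; inj₂; [_,_]′)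
open import Data.Vec as Vec using (Vec; []; _∷_; _++_; here; there; lookup; _[_]≔_; tabulate)
open import Data.Vec.Properties using ([]=⇒lookup; lookup⇒[]=; lookup∘update; lookup∘update′; lookup∘tabulate)
open import Function using (_∘_; _$_)
open import Function.Bundles using (module Equivalence)
import Relation.Unary as U
open import Relation.Nullary using (¬_; Dec; yes; no; does; contradiction)
open import Relation.Nullary.Decidable using (T?; ¬?; _×-dec_; map′)
open import Relation.Binary.PropositionalEquality
  using (_≡_; _≢_; refl; sym; trans; cong; cong₂; subst; module ≡-Reasoning)

open Equivalence using (to; from)
open import Algebra.Properties.CommutativeSemigroup +-commutativeSemigroup using (x∙yz≈y∙xz; interchange)

private
  variable
    n m N : ℕ

Edge : Graph n → Fin n → Fin n → Set
Edge X x y = T (X x y)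

T-not⁺ : ∀ {b} → ¬ T b → T (not b)
T-not⁺ {false} _ = _
T-not⁺ {true} ¬b = ¬b _

T-not⁻ : ∀ {b} → T (not b) → ¬ T b
T-not⁻ {false} _ ()

xor-not : ∀ b → b xor not b ≡ true
xor-not true = refl
xor-not false = refl

==-refl : (x : Fin n) → (x == x) ≡ true
==-refl x with x ≟ x
... | yes _ = refl
... | no x≢x = contradiction refl x≢x

==-≢ : ∀ {x y : Fin n} → x ≢ y → (x == y) ≡ false
==-≢ {x = x} {y} x≢y with x ≟ y
... | yes x≡y = contradiction x≡y x≢y
... | no _ = refl

==⇒≡ : ∀ {x y : Fin n} → T (x == y) → x ≡ y
==⇒≡ {x = x} {y} h with x ≟ y
... | yes x≡y = x≡y

≡⇒== : ∀ {x y : Fin n} → x ≡ y → T (x == y)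
≡⇒== {x = x} refl = subst T (sym (==-refl x)) _

==-sym : (x y : Fin n) → (x == y) ≡ (y == x)
==-sym x y with x ≟ y | y ≟ x
... | yes _ | yes _ = refl
... | no _ | no _ = refl
... | yes x≡y | no y≢x = contradiction (sym x≡y) y≢x
... | no x≢y | yes y≡x = contradiction (sym y≡x) x≢y

edge-sym : ∀ {X : Graph N} → Symmetric X → ∀ {x y} → Edge X x y → Edge X y x
edge-sym X-sym {x} {y} = subst T (X-sym x y)

complement-edge⁺ : ∀ (X : Graph n) {x y} → ¬ Edge X x y → x ≢ y → Edge (complement X) x y
complement-edge⁺ X ¬xy x≢y = from T-∧ (T-not⁺ ¬xy , T-not⁺ (x≢y ∘ ==⇒≡))

complement-edge⁻ : ∀ (X : Graph n) {x y} → Edge (complement X) x y → ¬ Edge X x y × x ≢ y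
complement-edge⁻ X {x} {y} h = let ¬xy , x≢y = to (T-∧ {not (X x y)}) h in T-not⁻ ¬xy , T-not⁻ x≢y ∘ ≡⇒==

complement-sym : ∀ {X : Graph n} → Symmetric X → Symmetric (complement X)
complement-sym X-sym x y = cong₂ (λ e d → not e ∧ not d) (X-sym x y) (==-sym x y)

any-vertices⁺ : (p : Fin n → Bool) {x : Fin n} → T (p x) → T (any p (vertices n))
any-vertices⁺ p {x} px = any⁺ p (tabulate⁺ {P = T ∘ p} x px)

any-vertices⁻ : (p : Fin n → Bool) → T (any p (vertices n)) → ∃ λ x → T (p x)
any-vertices⁻ p h = tabulate⁻ (any⁻ p _ h)

subsets-complete : (S : Subset n) → S ∈ₗ subsets n
subsets-complete [] = Any.here refl
subsets-complete {suc n} (true ∷ S) = ∈-++⁺ˡ (∈-map⁺ (true ∷_) (subsets-complete S))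
subsets-complete {suc n} (false ∷ S) = ∈-++⁺ʳ _ (∈-map⁺ (false ∷_) (subsets-complete S))

all-subsets⁺ : (p : Subset n → Bool) → (∀ S → T (p S)) → T (all p (subsets n))
all-subsets⁺ {n} p h = all⁻ p {subsets n} (All.tabulate λ {S} _ → h S)

all-subsets⁻ : (p : Subset n → Bool) → T (all p (subsets n)) → ∀ S → T (p S)
all-subsets⁻ p h S = All.lookup (all⁺ p _ h) (subsets-complete S)

T-if⁺ : ∀ {b x} → (T b → T x) → T (if b then x else true)
T-if⁺ {true} h = h _
T-if⁺ {false} _ = _

T-if⁻ : ∀ {b x} → T (if b then x else true) → T b → T x
T-if⁻ {true} h _ = h

∈⇒∈ˢ : ∀ {x : Fin n} {S} → x ∈ S → T (x ∈ˢ S)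
∈⇒∈ˢ x∈S = subst T (sym ([]=⇒lookup x∈S)) _

∈ˢ⇒∈ : ∀ {x : Fin n} {S} → T (x ∈ˢ S) → x ∈ S
∈ˢ⇒∈ {x = x} {S} h = lookup⇒[]= x S (to T-≡ h)

∈-full : ∀ {x : Fin n} → x ∈ full n
∈-full {x = zero} = here
∈-full {x = suc x} = there ∈-full

∈-tabulate⁺ : ∀ {f : Fin n → Bool} {x} → T (f x) → x ∈ tabulate f
∈-tabulate⁺ {f = f} {x} fx = ∈ˢ⇒∈ (subst T (sym (lookup∘tabulate f x)) fx)

∈-tabulate⁻ : ∀ {f : Fin n → Bool} {x} → x ∈ tabulate f → T (f x)
∈-tabulate⁻ {f = f} {x} x∈ = subst T (lookup∘tabulate f x) (∈⇒∈ˢ x∈)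

x∈p─q⇒x∉q : ∀ {x : Fin n} (p q : Subset n) → x ∈ p ─ q → x ∉ q
x∈p─q⇒x∉q (_ ∷ p) (false ∷ q) here ()
x∈p─q⇒x∉q (_ ∷ p) (_ ∷ q) (there x∈p─q) (there x∈q) = x∈p─q⇒x∉q p q x∈p─q x∈q

x∈p-y⇒x≢y : ∀ {x y : Fin n} (p : Subset n) → x ∈ p - y → x ≢ y
x∈p-y⇒x≢y {y = y} p x∈p-y refl = x∈p─q⇒x∉q p ⁅ y ⁆ x∈p-y (x∈⁅x⁆ y)

x∈p∧x∉p-y⇒x≡y : ∀ {x y : Fin n} {p : Subset n} → x ∈ p → x ∉ p - y → x ≡ y
x∈p∧x∉p-y⇒x≡y {x = x} {y} x∈p x∉p-y with x ≟ y
... | yes x≡y = x≡y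
... | no x≢y = contradiction (x∈p∧x≢y⇒x∈p-y x∈p x≢y) x∉p-y

two-distinct : ∀ {A : Set} {P : A → Set} {xs : List A} → 2 ≤ length xs → All P xs → Unique xs →
  ∃₂ λ x y → x ≢ y × P x × P y
two-distinct {xs = x ∷ y ∷ _} _ (Px ∷ Py ∷ _) ((x≢y ∷ _) ∷ _) = x , y , x≢y , Px , Py
two-distinct {xs = _ ∷ []} (s≤s ())

two-witnesses : ∀ {P : Fin n → Set} (P? : U.Decidable P) → 2 ≤ length (filter P? (allFin n)) →
  ∃₂ λ x y → x ≢ y × P x × P y
two-witnesses {n} P? two = two-distinct two (all-filter P? (allFin n)) (Unique.filter⁺ P? (Unique.allFin⁺ n))

-- Connectivity of induced subgraphs

-- A record rather than T (connectedᵇ X S), so that X and S can be inferred from the type.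
record IsConnected (X : Graph N) (S : Subset N) : Set where
  constructor connected
  field
    holds : T (connectedᵇ X S)

record ProperPart (U S : Subset N) : Set where
  constructor proper
  field
    U⊆S   : U ⊆ S
    inner : Nonempty U
    outer : ∃ λ y → y ∈ S × y ∉ U

Crossing : Graph N → Subset N → Subset N → Set
Crossing X S U = ∃₂ λ x y → x ∈ U × y ∈ S × y ∉ U × Edge X x y

private
  _∖ᵇ_ : Subset N → Subset N → Fin N → Bool
  (U ∖ᵇ S) x = x ∈ˢ U ∧ not (x ∈ˢ S)

  ∖ᵇ⁺ : ∀ {U S : Subset N} {x} → x ∈ U → x ∉ S → T ((U ∖ᵇ S) x)
  ∖ᵇ⁺ x∈U x∉S = from T-∧ (∈⇒∈ˢ x∈U , T-not⁺ (x∉S ∘ ∈ˢ⇒∈))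

  ∖ᵇ⁻ : ∀ (U S : Subset N) {x} → T ((U ∖ᵇ S) x) → x ∈ U × x ∉ S
  ∖ᵇ⁻ U S {x} h = let a , b = to (T-∧ {x ∈ˢ U}) h in ∈ˢ⇒∈ a , T-not⁻ b ∘ ∈⇒∈ˢ

-- The Boolean tests inside connectedᵇ, spelled out so that they unfold definitionally.
module _ (X : Graph N) (S : Subset N) where

  private
    properᵇ crossingᵇ : Subset N → Bool
    crossesᵇ : Subset N → Fin N → Fin N → Bool
    properᵇ U = nonemptyᵇ U ∧ (not (any (U ∖ᵇ S) (vertices N)) ∧ any (S ∖ᵇ U) (vertices N))
    crossingᵇ U = any (λ x → any (crossesᵇ U x) (vertices N)) (vertices N)
    crossesᵇ U x y = x ∈ˢ U ∧ (y ∈ˢ S ∧ (not (y ∈ˢ U) ∧ X x y))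

    properᵇ⁺ : ∀ {U} → ProperPart U S → T (properᵇ U)
    properᵇ⁺ {U} (proper U⊆S (x , x∈U) (y , y∈S , y∉U)) =
      from T-∧ ( any-vertices⁺ (_∈ˢ U) (∈⇒∈ˢ x∈U)
               , from T-∧ (T-not⁺ escapes , any-vertices⁺ (S ∖ᵇ U) (∖ᵇ⁺ y∈S y∉U)))
      where
      escapes : ¬ T (any (U ∖ᵇ S) (vertices N))
      escapes h = let z , z∈U∖S = any-vertices⁻ (U ∖ᵇ S) h
                      z∈U , z∉S = ∖ᵇ⁻ U S z∈U∖S
                  in z∉S (U⊆S z∈U)

    properᵇ⁻ : ∀ {U} → T (properᵇ U) → ProperPart U S
    properᵇ⁻ {U} h =
      let nonempty , rest = to (T-∧ {nonemptyᵇ U}) h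
          contained , remainder = to (T-∧ {not (any (U ∖ᵇ S) (vertices N))}) rest
          y , y∈S∖U = any-vertices⁻ (S ∖ᵇ U) remainder
      in proper (U⊆S contained) (Product.map₂ ∈ˢ⇒∈ (any-vertices⁻ (_∈ˢ U) nonempty))
                (y , ∖ᵇ⁻ S U y∈S∖U)
      where
      U⊆S : T (not (any (U ∖ᵇ S) (vertices N))) → U ⊆ S
      U⊆S contained {z} z∈U with z ∈? S
      ... | yes z∈S = z∈S
      ... | no z∉S = ⊥-elim (T-not⁻ contained (any-vertices⁺ (U ∖ᵇ S) (∖ᵇ⁺ z∈U z∉S)))

    crossingᵇ⁺ : ∀ {U} → Crossing X S U → T (crossingᵇ U)
    crossingᵇ⁺ {U} (x , y , x∈U , y∈S , y∉U , xy) =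
      any-vertices⁺ (λ x → any (crossesᵇ U x) (vertices N)) $ any-vertices⁺ (crossesᵇ U x) $
        from T-∧ (∈⇒∈ˢ x∈U , from T-∧ (∈⇒∈ˢ y∈S , from T-∧ (T-not⁺ (y∉U ∘ ∈ˢ⇒∈) , xy)))

    crossingᵇ⁻ : ∀ {U} → T (crossingᵇ U) → Crossing X S U
    crossingᵇ⁻ {U} h =
      let x , hx = any-vertices⁻ (λ x → any (crossesᵇ U x) (vertices N)) h
          y , hy = any-vertices⁻ (crossesᵇ U x) hx
          x∈U , rest = to (T-∧ {x ∈ˢ U}) hy
          y∈S , rest′ = to (T-∧ {y ∈ˢ S}) rest
          y∉U , xy = to (T-∧ {not (y ∈ˢ U)}) rest′
      in x , y , ∈ˢ⇒∈ x∈U , ∈ˢ⇒∈ y∈S , T-not⁻ y∉U ∘ ∈⇒∈ˢ , xy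

  connected⇒nonempty : IsConnected X S → Nonempty S
  connected⇒nonempty (connected c) =
    Product.map₂ ∈ˢ⇒∈ (any-vertices⁻ (_∈ˢ S) (to (T-∧ {nonemptyᵇ S}) c .proj₁))

  connected⇒crossing : ∀ {U} → IsConnected X S → ProperPart U S → Crossing X S U
  connected⇒crossing {U} (connected c) U⊂S =
    crossingᵇ⁻ (T-if⁻ (all-subsets⁻ _ (to (T-∧ {nonemptyᵇ S}) c .proj₂) U) (properᵇ⁺ U⊂S))

  crossing⇒connected : Nonempty S → (∀ {U} → ProperPart U S → Crossing X S U) → IsConnected X S
  crossing⇒connected (x , x∈S) cross = connected $
    from T-∧ ( any-vertices⁺ (_∈ˢ S) (∈⇒∈ˢ x∈S)
             , all-subsets⁺ _ λ U → T-if⁺ (crossingᵇ⁺ ∘ cross ∘ properᵇ⁻ {U}))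

module _ {X : Graph N} {S : Subset N} where

  no-crossing⇒disconnected : ∀ {U} → ProperPart U S →
    (∀ {x y} → x ∈ U → y ∈ S → y ∉ U → ¬ Edge X x y) → ¬ IsConnected X S
  no-crossing⇒disconnected U⊂S none c =
    let x , y , x∈U , y∈S , y∉U , xy = connected⇒crossing X S c U⊂S in none x∈U y∈S y∉U xy

  isolated⇒disconnected : ∀ {r y} → r ∈ S → y ∈ S → y ≢ r →
    (∀ {z} → z ∈ S → ¬ Edge X r z) → ¬ IsConnected X S
  isolated⇒disconnected {r} r∈S y∈S y≢r isolated =
    no-crossing⇒disconnected
      (proper (λ x∈⁅r⁆ → subst (_∈ S) (sym (x∈⁅y⁆⇒x≡y r x∈⁅r⁆)) r∈S)
              (r , x∈⁅x⁆ r) (_ , y∈S , x≢y⇒x∉⁅y⁆ y≢r))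
      (λ x∈⁅r⁆ z∈S _ → isolated z∈S ∘ subst (λ x → Edge X x _) (x∈⁅y⁆⇒x≡y r x∈⁅r⁆))

  singleton-connected : ∀ {r} → r ∈ S → (∀ {x} → x ∈ S → x ≡ r) → IsConnected X S
  singleton-connected r∈S only-r = crossing⇒connected X S (_ , r∈S) λ where
    (proper U⊆S (x , x∈U) (y , y∈S , y∉U)) →
      contradiction (subst (_∈ _) (trans (only-r (U⊆S x∈U)) (sym (only-r y∈S))) x∈U) y∉U

  connected-transfer : ∀ {Y : Graph N} → IsConnected X S →
    (∀ {U} → ProperPart U S → Crossing X S U → Crossing Y S U) → IsConnected Y S
  connected-transfer c X⇒Y = crossing⇒connected _ S (connected⇒nonempty X S c) λ U⊂S →
    X⇒Y U⊂S (connected⇒crossing X S c U⊂S)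

  connected-mono : ∀ {Y : Graph N} → IsConnected X S →
    (∀ {x y} → x ∈ S → y ∈ S → Edge X x y → Edge Y x y) → IsConnected Y S
  connected-mono c X⇒Y = connected-transfer c λ where
    (proper U⊆S _ _) (x , y , x∈U , y∈S , y∉U , xy) → x , y , x∈U , y∈S , y∉U , X⇒Y (U⊆S x∈U) y∈S xy

module _ {X : Graph N} (X-sym : Symmetric X) {C S : Subset N}
         (attach : ∀ {x} → x ∈ S → x ∉ C → ∃ λ p → p ∈ C × Edge X x p) where

  -- A cut of S either splits C, and is crossed inside C, or has all of C on one side; then the
  -- attaching edge of a vertex on the other side crosses it.
  connected-by-attachment : IsConnected X C → C ⊆ S → IsConnected X S
  connected-by-attachment C-conn C⊆S =
    crossing⇒connected X S (Product.map₂ C⊆S (connected⇒nonempty X C C-conn)) cross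
    where
    cross : ∀ {U} → ProperPart U S → Crossing X S U
    cross {U} (proper U⊆S (x , x∈U) (y , y∈S , y∉U)) with any? (λ c → c ∈? C ×-dec ¬? (c ∈? U))
    ... | no C⊈U with attach y∈S (λ y∈C → C⊈U (y , y∈C , y∉U))
    ...   | p , p∈C , yp with p ∈? U
    ...     | yes p∈U = p , y , p∈U , y∈S , y∉U , edge-sym X-sym yp
    ...     | no p∉U = contradiction (p , p∈C , p∉U) C⊈U
    cross {U} (proper U⊆S (x , x∈U) (y , y∈S , y∉U)) | yes (c′ , c′∈C , c′∉U)
      with any? (λ c → c ∈? C ×-dec c ∈? U)
    ... | yes (c , c∈C , c∈U) =
      let a , b , a∈U∩C , b∈C , b∉U∩C , ab =
            connected⇒crossing X C C-conn
              (proper (p∩q⊆q U C) (c , x∈p∩q⁺ (c∈U , c∈C)) (c′ , c′∈C , c′∉U ∘ proj₁ ∘ x∈p∩q⁻ U C))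
      in a , b , x∈p∩q⁻ U C a∈U∩C .proj₁ , C⊆S b∈C , (λ b∈U → b∉U∩C (x∈p∩q⁺ (b∈U , b∈C))) , ab
    ... | no C∩U≡∅ =
      let p , p∈C , xp = attach (U⊆S x∈U) (λ x∈C → C∩U≡∅ (x , x∈C , x∈U))
      in x , p , x∈U , C⊆S p∈C , (λ p∈U → C∩U≡∅ (p , p∈C , p∈U)) , xp

star-connected : ∀ {X : Graph N} {S r} → Symmetric X → r ∈ S → (∀ {x} → x ∈ S → x ≢ r → Edge X x r) →
  IsConnected X S
star-connected {S = S} {r} X-sym r∈S adj =
  connected-by-attachment X-sym (λ x∈S x∉⁅r⁆ → r , x∈⁅x⁆ r , adj x∈S (x∉⁅r⁆ ∘ λ { refl → x∈⁅x⁆ r }))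
    (singleton-connected (x∈⁅x⁆ r) (x∈⁅y⁆⇒x≡y r))
    (λ x∈⁅r⁆ → subst (_∈ S) (sym (x∈⁅y⁆⇒x≡y r x∈⁅r⁆)) r∈S)

connected⇒leaving-edge : ∀ {X : Graph n} → Connected X → ∀ {U x y} → x ∈ U → y ∉ U →
  ∃₂ λ a b → a ∈ U × b ∉ U × Edge X a b
connected⇒leaving-edge {X = X} conn x∈U y∉U =
  let a , b , a∈U , _ , b∉U , ab =
        connected⇒crossing X _ (connected conn) (proper (λ _ → ∈-full) (_ , x∈U) (_ , ∈-full , y∉U))
  in a , b , a∈U , b∉U , ab

-- Vertex sets of a disjoint union

data Side {n m : ℕ} : Fin (n + m) → Set where
  left : (a : Fin n) → Side (a ↑ˡ m)
  right : (j : Fin m) → Side (n ↑ʳ j)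

side : ∀ {n m} (x : Fin (n + m)) → Side {n} {m} x
side {n} x with splitAt n x in eq
... | inj₁ a = subst Side (splitAt⁻¹-↑ˡ eq) (left a)
... | inj₂ j = subst Side (splitAt⁻¹-↑ʳ eq) (right j)

module _ {n m : ℕ} where

  ↑ˡ≢↑ʳ : ∀ (a : Fin n) (j : Fin m) → a ↑ˡ m ≢ n ↑ʳ j
  ↑ˡ≢↑ʳ a j eq with trans (sym (splitAt-↑ˡ n a m)) (trans (cong (splitAt n) eq) (splitAt-↑ʳ n m j))
  ... | ()

  ↑ˡ-== : ∀ (a b : Fin n) → ((a ↑ˡ m) == (b ↑ˡ m)) ≡ (a == b)
  ↑ˡ-== a b with a ≟ b | a ↑ˡ m ≟ b ↑ˡ m
  ... | yes _ | yes _ = refl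
  ... | no _ | no _ = refl
  ... | yes a≡b | no a↑≢b↑ = contradiction (cong (_↑ˡ m) a≡b) a↑≢b↑
  ... | no a≢b | yes a↑≡b↑ = contradiction (↑ˡ-injective m a b a↑≡b↑) a≢b

  ↑ʳ-== : ∀ (i j : Fin m) → ((n ↑ʳ i) == (n ↑ʳ j)) ≡ (i == j)
  ↑ʳ-== i j with i ≟ j | n ↑ʳ i ≟ n ↑ʳ j
  ... | yes _ | yes _ = refl
  ... | no _ | no _ = refl
  ... | yes i≡j | no i↑≢j↑ = contradiction (cong (n ↑ʳ_) i≡j) i↑≢j↑
  ... | no i≢j | yes i↑≡j↑ = contradiction (↑ʳ-injective n i j i↑≡j↑) i≢j

↑ˡ-∈⁺ : ∀ (A : Subset n) {B : Subset m} {a} → a ∈ A → a ↑ˡ m ∈ A ++ B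
↑ˡ-∈⁺ (_ ∷ A) here = here
↑ˡ-∈⁺ (_ ∷ A) (there a∈A) = there (↑ˡ-∈⁺ A a∈A)

↑ˡ-∈⁻ : ∀ (A : Subset n) {B : Subset m} {a} → a ↑ˡ m ∈ A ++ B → a ∈ A
↑ˡ-∈⁻ (_ ∷ A) {a = zero} here = here
↑ˡ-∈⁻ (_ ∷ A) {a = suc a} (there a∈A) = there (↑ˡ-∈⁻ A a∈A)

↑ʳ-∈⁺ : ∀ (A : Subset n) {B : Subset m} {j} → j ∈ B → n ↑ʳ j ∈ A ++ B
↑ʳ-∈⁺ [] j∈B = j∈B
↑ʳ-∈⁺ (_ ∷ A) j∈B = there (↑ʳ-∈⁺ A j∈B)

↑ʳ-∈⁻ : ∀ (A : Subset n) {B : Subset m} {j} → n ↑ʳ j ∈ A ++ B → j ∈ B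
↑ʳ-∈⁻ [] j∈B = j∈B
↑ʳ-∈⁻ (_ ∷ A) (there j∈B) = ↑ʳ-∈⁻ A j∈B

↑ˡ-connected : ∀ {X : Graph n} {Y : Graph (n + m)} {A : Subset n} →
  (∀ a b → Y (a ↑ˡ m) (b ↑ˡ m) ≡ X a b) → IsConnected X A → IsConnected Y (A ++ ∅)
↑ˡ-connected {n} {m} {X} {Y} {A} Y≡X c =
  crossing⇒connected Y (A ++ ∅) (let a , a∈A = connected⇒nonempty X A c in a ↑ˡ m , ↑ˡ-∈⁺ A a∈A) cross
  where
  cross : ∀ {U} → ProperPart U (A ++ ∅) → Crossing Y (A ++ ∅) U
  cross {U} U⊂S with Vec.splitAt n U
  ... | Uˡ , Uʳ , refl =
    let a , b , a∈Uˡ , b∈A , b∉Uˡ , ab = connected⇒crossing X A c (proper Uˡ⊆A inner′ outer′)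
    in a ↑ˡ m , b ↑ˡ m , ↑ˡ-∈⁺ Uˡ a∈Uˡ , ↑ˡ-∈⁺ A b∈A , b∉Uˡ ∘ ↑ˡ-∈⁻ Uˡ ,
       subst T (sym (Y≡X a b)) ab
    where
    open ProperPart U⊂S
    Uˡ⊆A : Uˡ ⊆ A
    Uˡ⊆A a∈Uˡ = ↑ˡ-∈⁻ A (U⊆S (↑ˡ-∈⁺ Uˡ a∈Uˡ))
    inner′ : Nonempty Uˡ
    inner′ with inner
    ... | x , x∈U with side {n} {m} x
    ...   | left a = a , ↑ˡ-∈⁻ Uˡ x∈U
    ...   | right j = contradiction (↑ʳ-∈⁻ A (U⊆S x∈U)) ∉⊥
    outer′ : ∃ λ b → b ∈ A × b ∉ Uˡ
    outer′ with outer
    ... | y , y∈S , y∉U with side {n} {m} y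
    ...   | left b = b , ↑ˡ-∈⁻ A y∈S , y∉U ∘ ↑ˡ-∈⁺ Uˡ
    ...   | right j = contradiction (↑ʳ-∈⁻ A y∈S) ∉⊥

-- Counting over the subsets of Fin n

connected? : (X : Graph N) (S : Subset N) → Dec (IsConnected X S)
connected? X S = map′ connected IsConnected.holds (T? (connectedᵇ X S))

𝟙 : ∀ {P : Set} → Dec P → ℕ
𝟙 p = if does p then 1 else 0

𝟙≤1 : ∀ {P : Set} (p : Dec P) → 𝟙 p ≤ 1
𝟙≤1 (yes _) = ≤-refl
𝟙≤1 (no _) = z≤n

𝟙-yes : ∀ {P : Set} (p : Dec P) → P → 𝟙 p ≡ 1
𝟙-yes (yes _) _ = refl
𝟙-yes (no ¬P) P = contradiction P ¬P

𝟙-no : ∀ {P : Set} (p : Dec P) → ¬ P → 𝟙 p ≡ 0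
𝟙-no (yes P) ¬P = contradiction P ¬P
𝟙-no (no _) _ = refl

𝟙-mono : ∀ {P Q : Set} (p : Dec P) (q : Dec Q) → (P → Q) → 𝟙 p ≤ 𝟙 q
𝟙-mono (yes P) (yes _) _ = ≤-refl
𝟙-mono (yes P) (no ¬Q) P⇒Q = contradiction (P⇒Q P) ¬Q
𝟙-mono (no _) q _ = z≤n

𝟙-× : ∀ {P Q : Set} (p : Dec P) (q : Dec Q) → 𝟙 (p ×-dec q) ≡ 𝟙 p * 𝟙 q
𝟙-× (yes _) (yes _) = refl
𝟙-× (yes _) (no _) = refl
𝟙-× (no _) q = refl

1≤𝟙+𝟙 : ∀ {R S : Set} (r : Dec R) (s : Dec S) → R ⊎ S → 1 ≤ 𝟙 r + 𝟙 s
1≤𝟙+𝟙 r s (inj₁ R) rewrite 𝟙-yes r R = s≤s z≤n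
1≤𝟙+𝟙 r s (inj₂ S) rewrite 𝟙-yes s S = m≤n+m 1 (𝟙 r)

𝟙-pair : ∀ {P Q R S : Set} (p : Dec P) (q : Dec Q) (r : Dec R) (s : Dec S) →
  (P → Q → R × S) → R ⊎ S → 𝟙 p + 𝟙 q ≤ 𝟙 r + 𝟙 s
𝟙-pair (yes P) (yes Q) r s both _ =
  let R , S = both P Q in ≤-reflexive (cong₂ _+_ (sym (𝟙-yes r R)) (sym (𝟙-yes s S)))
𝟙-pair (yes _) (no _) r s _ R⊎S = 1≤𝟙+𝟙 r s R⊎S
𝟙-pair (no _) q r s _ R⊎S = ≤-trans (𝟙≤1 q) (1≤𝟙+𝟙 r s R⊎S)

𝟙-exclusive : ∀ {P Q : Set} (p : Dec P) (q : Dec Q) → (P → ¬ Q) → 𝟙 p + 𝟙 q ≤ 1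
𝟙-exclusive (yes P) (yes Q) P⇒¬Q = contradiction Q (P⇒¬Q P)
𝟙-exclusive (yes _) (no _) _ = ≤-refl
𝟙-exclusive (no _) q _ = 𝟙≤1 q

conn : Graph N → Subset N → ℕ
conn X S = 𝟙 (connected? X S)

conn-mono : ∀ {X Y : Graph N} {S} → (IsConnected X S → IsConnected Y S) → conn X S ≤ conn Y S
conn-mono = 𝟙-mono (connected? _ _) (connected? _ _)

conn-yes : ∀ {X : Graph N} {S} → IsConnected X S → conn X S ≡ 1
conn-yes = 𝟙-yes (connected? _ _)

conn-no : ∀ {X : Graph N} {S} → ¬ IsConnected X S → conn X S ≡ 0
conn-no = 𝟙-no (connected? _ _)

∑ : (n : ℕ) → (Subset n → ℕ) → ℕ
∑ zero f = f []
∑ (suc n) f = ∑ n (f ∘ (true ∷_)) + ∑ n (f ∘ (false ∷_))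

module _ where
  open ≡-Reasoning

  ∑-cong : ∀ {f g : Subset n → ℕ} → (∀ A → f A ≡ g A) → ∑ n f ≡ ∑ n g
  ∑-cong {zero} f≗g = f≗g []
  ∑-cong {suc n} f≗g = cong₂ _+_ (∑-cong (f≗g ∘ (true ∷_))) (∑-cong (f≗g ∘ (false ∷_)))

  ∑-+ : ∀ (f g : Subset n → ℕ) → ∑ n (λ A → f A + g A) ≡ ∑ n f + ∑ n g
  ∑-+ {zero} f g = refl
  ∑-+ {suc n} f g = begin
    ∑ n (λ A → f (true ∷ A) + g (true ∷ A)) + ∑ n (λ A → f (false ∷ A) + g (false ∷ A))
      ≡⟨ cong₂ _+_ (∑-+ (f ∘ (true ∷_)) (g ∘ (true ∷_))) (∑-+ (f ∘ (false ∷_)) (g ∘ (false ∷_))) ⟩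
    (∑ n (f ∘ (true ∷_)) + ∑ n (g ∘ (true ∷_))) + (∑ n (f ∘ (false ∷_)) + ∑ n (g ∘ (false ∷_)))
      ≡⟨ interchange (∑ n (f ∘ (true ∷_))) _ _ _ ⟩
    ∑ (suc n) f + ∑ (suc n) g ∎

  ∑-*ʳ : ∀ (f : Subset n → ℕ) c → ∑ n (λ A → f A * c) ≡ ∑ n f * c
  ∑-*ʳ {zero} f c = refl
  ∑-*ʳ {suc n} f c = trans (cong₂ _+_ (∑-*ʳ (f ∘ (true ∷_)) c) (∑-*ʳ (f ∘ (false ∷_)) c))
                           (sym (*-distribʳ-+ c (∑ n (f ∘ (true ∷_))) _))

  ∑-mono-≤ : ∀ {f g : Subset n → ℕ} → (∀ A → f A ≤ g A) → ∑ n f ≤ ∑ n g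
  ∑-mono-≤ {zero} f≤g = f≤g []
  ∑-mono-≤ {suc n} f≤g = +-mono-≤ (∑-mono-≤ (f≤g ∘ (true ∷_))) (∑-mono-≤ (f≤g ∘ (false ∷_)))

  ∑-mono-< : ∀ {f g : Subset n → ℕ} → (∀ A → f A ≤ g A) → ∀ A₀ → f A₀ < g A₀ → ∑ n f < ∑ n g
  ∑-mono-< {zero} f≤g [] f<g = f<g
  ∑-mono-< {suc n} f≤g (true ∷ A₀) f<g =
    +-mono-<-≤ (∑-mono-< (f≤g ∘ (true ∷_)) A₀ f<g) (∑-mono-≤ (f≤g ∘ (false ∷_)))
  ∑-mono-< {suc n} f≤g (false ∷ A₀) f<g =
    +-mono-≤-< (∑-mono-≤ (f≤g ∘ (true ∷_))) (∑-mono-< (f≤g ∘ (false ∷_)) A₀ f<g)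

  ∑-++ : ∀ n {m} (h : Subset (n + m) → ℕ) → ∑ (n + m) h ≡ ∑ n (λ A → ∑ m (λ B → h (A ++ B)))
  ∑-++ zero h = refl
  ∑-++ (suc n) h = cong₂ _+_ (∑-++ n (h ∘ (true ∷_))) (∑-++ n (h ∘ (false ∷_)))

  ∑-++-+ : ∀ n {m} (f : Subset n → Subset m → ℕ) (h : Subset (n + m) → ℕ) →
    ∑ n (λ A → ∑ m (λ B → f A B + h (A ++ B))) ≡ ∑ n (λ A → ∑ m (f A)) + ∑ (n + m) h
  ∑-++-+ n {m} f h = begin
    ∑ n (λ A → ∑ m (λ B → f A B + h (A ++ B)))             ≡⟨ ∑-cong (λ A → ∑-+ (f A) (h ∘ (A ++_))) ⟩
    ∑ n (λ A → ∑ m (f A) + ∑ m (h ∘ (A ++_)))              ≡⟨ ∑-+ (λ A → ∑ m (f A)) _ ⟩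
    ∑ n (λ A → ∑ m (f A)) + ∑ n (λ A → ∑ m (h ∘ (A ++_)))  ≡⟨ cong₂ _+_ refl (sym (∑-++ n h)) ⟩
    ∑ n (λ A → ∑ m (f A)) + ∑ (n + m) h                    ∎

  ∑-zero : ∀ n → ∑ n (λ _ → 0) ≡ 0
  ∑-zero zero = refl
  ∑-zero (suc n) = cong₂ _+_ (∑-zero n) (∑-zero n)

  ∑-pos : ∀ {f : Subset n → ℕ} A₀ → 0 < f A₀ → 0 < ∑ n f
  ∑-pos {n} {f} A₀ pos = subst (_< ∑ n f) (∑-zero n) (∑-mono-< (λ _ → z≤n) A₀ pos)

length-filter-map : ∀ {A B : Set} {P : B → Set} (P? : U.Decidable P) (f : A → B) xs →
  length (filter P? (map f xs)) ≡ length (filter (P? ∘ f) xs)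
length-filter-map P? f [] = refl
length-filter-map P? f (x ∷ xs) with does (P? (f x))
... | true = cong suc (length-filter-map P? f xs)
... | false = length-filter-map P? f xs

count-subsets : ∀ (p : Subset n → Bool) (p? : ∀ S → Dec (T (p S))) →
  length (filter p? (subsets n)) ≡ ∑ n (λ S → if p S then 1 else 0)
count-subsets {zero} p p? with p [] | p? []
... | true | yes _ = refl
... | true | no ¬⊤ = contradiction _ ¬⊤
... | false | no _ = refl
count-subsets {suc n} p p? = begin
  length (filter p? (subsets (suc n)))
    ≡⟨ cong length (filter-++ p? (map (true ∷_) (subsets n)) _) ⟩
  length (filter p? (map (true ∷_) (subsets n)) List.++ filter p? (map (false ∷_) (subsets n)))
    ≡⟨ length-++ (filter p? (map (true ∷_) (subsets n))) ⟩
  length (filter p? (map (true ∷_) (subsets n))) + length (filter p? (map (false ∷_) (subsets n)))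
    ≡⟨ cong₂ _+_ (length-filter-map p? (true ∷_) (subsets n)) (length-filter-map p? (false ∷_) (subsets n)) ⟩
  length (filter (p? ∘ (true ∷_)) (subsets n)) + length (filter (p? ∘ (false ∷_)) (subsets n))
    ≡⟨ cong₂ _+_ (count-subsets (p ∘ (true ∷_)) (p? ∘ (true ∷_)))
                 (count-subsets (p ∘ (false ∷_)) (p? ∘ (false ∷_))) ⟩
  ∑ (suc n) (λ S → if p S then 1 else 0) ∎
  where open ≡-Reasoning

η-as-∑ : (X : Graph N) → η X ≡ ∑ N (conn X)
η-as-∑ X = count-subsets (connectedᵇ X) _

η+η-as-∑ : (X Y : Graph N) → η X + η Y ≡ ∑ N (λ S → conn X S + conn Y S)
η+η-as-∑ X Y = trans (cong₂ _+_ (η-as-∑ X) (η-as-∑ Y)) (sym (∑-+ (conn X) (conn Y)))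

∑-nonempty-pos : ∀ k → 1 ≤ k → 0 < ∑ k (𝟙 ∘ nonempty?)
∑-nonempty-pos (suc k) _ =
  ∑-pos {suc k} {𝟙 ∘ nonempty?} ⁅ zero ⁆ (≤-reflexive (sym (𝟙-yes (nonempty? ⁅ zero ⁆) ⁅zero⁆≠∅)))
  where
  ⁅zero⁆≠∅ : Nonempty {suc k} ⁅ zero ⁆
  ⁅zero⁆≠∅ = zero , here

-- The condition c is read with coordinate i cleared, so toggling twice is the identity and sums over
-- the cube are unchanged.
toggle : Fin n → (Subset n → Bool) → Subset n → Subset n
toggle i c A = A [ i ]≔ (lookup A i xor c (A [ i ]≔ false))

∑-toggle : ∀ (i : Fin n) c f → ∑ n (f ∘ toggle i c) ≡ ∑ n f
∑-toggle {suc n} zero c f = begin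
  ∑ n (λ A → f (not (c (false ∷ A)) ∷ A)) + ∑ n (λ A → f (c (false ∷ A) ∷ A))
    ≡⟨ sym (∑-+ (λ A → f (not (c (false ∷ A)) ∷ A)) _) ⟩
  ∑ n (λ A → f (not (c (false ∷ A)) ∷ A) + f (c (false ∷ A) ∷ A))
    ≡⟨ ∑-cong swap ⟩
  ∑ n (λ A → f (true ∷ A) + f (false ∷ A))
    ≡⟨ ∑-+ (f ∘ (true ∷_)) _ ⟩
  ∑ (suc n) f ∎
  where
  open ≡-Reasoning
  swap : ∀ A → f (not (c (false ∷ A)) ∷ A) + f (c (false ∷ A) ∷ A) ≡ f (true ∷ A) + f (false ∷ A)
  swap A with c (false ∷ A)
  ... | true = +-comm (f (false ∷ A)) _
  ... | false = refl
∑-toggle {suc n} (suc i) c f =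
  cong₂ _+_ (∑-toggle i (c ∘ (true ∷_)) (f ∘ (true ∷_))) (∑-toggle i (c ∘ (false ∷_)) (f ∘ (false ∷_)))

toggles : List (Fin n × (Subset n → Bool)) → Subset n → Subset n
toggles [] A = A
toggles ((i , c) ∷ ts) A = toggles ts (toggle i c A)

∑-toggles : ∀ ts (f : Subset n → ℕ) → ∑ n (f ∘ toggles ts) ≡ ∑ n f
∑-toggles [] f = refl
∑-toggles ((i , c) ∷ ts) f = trans (∑-toggle i c (f ∘ toggles ts)) (∑-toggles ts f)

toggle-≡ : ∀ (i : Fin n) c A → lookup (toggle i c A) i ≡ lookup A i xor c (A [ i ]≔ false)
toggle-≡ i c A = lookup∘update i A _

toggle-≢ : ∀ {i j : Fin n} c A → j ≢ i → lookup (toggle i c A) j ≡ lookup A j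
toggle-≢ c A j≢i = lookup∘update′ j≢i A _

toggles-≢ : ∀ {j : Fin n} ts A → All (λ (i , _) → j ≢ i) ts → lookup (toggles ts A) j ≡ lookup A j
toggles-≢ [] A [] = refl
toggles-≢ ((i , c) ∷ ts) A (j≢i ∷ j∉ts) = trans (toggles-≢ ts (toggle i c A) j∉ts) (toggle-≢ c A j≢i)

toggles-reflects-∈ : ∀ {j : Fin n} ts {A} → All (λ (i , _) → j ≢ i) ts → j ∈ toggles ts A → j ∈ A
toggles-reflects-∈ {j = j} ts {A} j∉ts j∈ = lookup⇒[]= j A (trans (sym (toggles-≢ ts A j∉ts)) ([]=⇒lookup j∈))

toggles-preserves-∈ : ∀ {j : Fin n} ts {A} → All (λ (i , _) → j ≢ i) ts → j ∈ A → j ∈ toggles ts A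
toggles-preserves-∈ {j = j} ts {A} j∉ts j∈A = lookup⇒[]= j _ (trans (toggles-≢ ts A j∉ts) ([]=⇒lookup j∈A))

module Anchored {n : ℕ} (G : Graph n) (v : Fin n) where

  AntiNeighbour : Subset n → Fin n → Set
  AntiNeighbour A w = w ∈ A × Edge (complement G) v w

  antiNeighbour? : (A : Subset n) → Dec (∃ (AntiNeighbour A))
  antiNeighbour? A = any? λ w → w ∈? A ×-dec T? (complement G v w)

  Gain Loss : Subset n → Set
  Gain A = v ∈ A × IsConnected G A × ∃ (AntiNeighbour A)
  Loss A = v ∈ A × (∃ λ a → a ∈ A × a ≢ v) × ¬ ∃ (AntiNeighbour A)

  no-anti-neighbour⇒adjacent : ∀ {A a} → ¬ ∃ (AntiNeighbour A) → a ∈ A → a ≢ v → Edge G v a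
  no-anti-neighbour⇒adjacent {a = a} no-anti a∈A a≢v with T? (G v a)
  ... | yes va = va
  ... | no ¬va = contradiction (a , a∈A , complement-edge⁺ G ¬va (a≢v ∘ sym)) no-anti

  closed-star : Symmetric G → ∀ {A} → v ∈ A → ¬ ∃ (AntiNeighbour A) → IsConnected G A
  closed-star G-sym v∈A no-anti =
    star-connected G-sym v∈A λ a∈A a≢v → edge-sym G-sym (no-anti-neighbour⇒adjacent no-anti a∈A a≢v)

  gain? : (A : Subset n) → Dec (Gain A)
  gain? A = v ∈? A ×-dec connected? G A ×-dec antiNeighbour? A

  loss? : (A : Subset n) → Dec (Loss A)
  loss? A = v ∈? A ×-dec (any? λ a → a ∈? A ×-dec ¬? (a ≟ v)) ×-dec ¬? (antiNeighbour? A)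

  InClosedNbhd : Subset n → Set
  InClosedNbhd A = v ∈ A × (∀ {a} → a ∈ A → a ≢ v → Edge G v a)

  loss⇒closed : ∀ {A} → Loss A → InClosedNbhd A
  loss⇒closed (v∈A , _ , no-anti) = v∈A , no-anti-neighbour⇒adjacent no-anti

  closed⇒anti∉ : ∀ {A m} → InClosedNbhd A → Edge (complement G) v m → lookup A m ≡ false
  closed⇒anti∉ {A} {m} (_ , near) anti =
    ¬-not λ m∈A →
      proj₁ (complement-edge⁻ G anti) (near (lookup⇒[]= m A m∈A) (proj₂ (complement-edge⁻ G anti) ∘ sym))

  -- {v} is in N[v] but is not a Loss set, hence the strict inequality.
  loss<gain-by-toggles : ∀ ts → (∀ {A} → InClosedNbhd A → Gain (toggles ts A)) →
    ∑ n (𝟙 ∘ loss?) < ∑ n (𝟙 ∘ gain?)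
  loss<gain-by-toggles ts image = begin-strict
    ∑ n (𝟙 ∘ loss?)
      <⟨ ∑-mono-< (λ A → 𝟙-mono (loss? A) (gain? _) (image ∘ loss⇒closed)) ⁅ v ⁆ at-singleton ⟩
    ∑ n (𝟙 ∘ gain? ∘ toggles ts)
      ≡⟨ ∑-toggles ts (𝟙 ∘ gain?) ⟩
    ∑ n (𝟙 ∘ gain?) ∎
    where
    open ≤-Reasoning
    v-only : ∀ {a} → a ∈ ⁅ v ⁆ → a ≢ v → Edge G v a
    v-only a∈⁅v⁆ a≢v = contradiction (x∈⁅y⁆⇒x≡y v a∈⁅v⁆) a≢v
    at-singleton : 𝟙 (loss? ⁅ v ⁆) < 𝟙 (gain? (toggles ts ⁅ v ⁆))
    at-singleton rewrite 𝟙-no (loss? ⁅ v ⁆) (λ (_ , (a , a∈⁅v⁆ , a≢v) , _) → a≢v (x∈⁅y⁆⇒x≡y v a∈⁅v⁆))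
                 | 𝟙-yes (gain? (toggles ts ⁅ v ⁆)) (image (x∈⁅x⁆ v , v-only)) = s≤s z≤n

  module _ (G-sym : Symmetric G) (G-irr : Irreflexive G) where

    edge⇒≢ : ∀ {x y} → Edge G x y → x ≢ y
    edge⇒≢ {x} xy refl = subst T (G-irr x) xy

    anti⇒≢ : ∀ {m} → Edge (complement G) v m → v ≢ m
    anti⇒≢ = proj₂ ∘ complement-edge⁻ G

    adjacent≢anti : ∀ {u m} → Edge G v u → Edge (complement G) v m → u ≢ m
    adjacent≢anti vu anti refl = proj₁ (complement-edge⁻ G anti) vu

    -- A \ {m₁, m₂} is a star at v, to which m₁ attaches through u₁, and then m₂ through q.
    gain-via-attachments : ∀ {A u₁ m₁ q m₂} →
      Edge G v u₁ → Edge G u₁ m₁ → Edge G q m₂ → Edge (complement G) v m₁ → Edge (complement G) v m₂ →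
      v ∈ A → (∀ {x} → x ∈ A → x ≢ v → x ≢ m₁ → x ≢ m₂ → Edge G v x) →
      (m₁ ∈ A → u₁ ∈ A) → (m₂ ∈ A → q ∈ A) → m₁ ∈ A ⊎ m₂ ∈ A → Gain A
    gain-via-attachments {A} {u₁} {m₁} {q} {m₂} vu₁ u₁m₁ qm₂ anti₁ anti₂ v∈A near m₁⇒u₁ m₂⇒q m₁∨m₂ =
      v∈A , connected-by-attachment G-sym attach-m₂ C₁-conn (p─q⊆p A ⁅ m₂ ⁆) , anti
      where
      C₀ C₁ : Subset n
      C₀ = A - m₁ - m₂
      C₁ = A - m₂

      v≢m₁ : v ≢ m₁
      v≢m₁ = anti⇒≢ anti₁
      v≢m₂ : v ≢ m₂
      v≢m₂ = anti⇒≢ anti₂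

      C₀⊆A : C₀ ⊆ A
      C₀⊆A = p─q⊆p A ⁅ m₁ ⁆ ∘ p─q⊆p (A - m₁) ⁅ m₂ ⁆

      C₀-conn : IsConnected G C₀
      C₀-conn = star-connected G-sym (x∈p∧x≢y⇒x∈p-y (x∈p∧x≢y⇒x∈p-y v∈A v≢m₁) v≢m₂) λ x∈C₀ x≢v →
        edge-sym G-sym (near (C₀⊆A x∈C₀) x≢v (x∈p-y⇒x≢y A (p─q⊆p (A - m₁) ⁅ m₂ ⁆ x∈C₀))
                                           (x∈p-y⇒x≢y (A - m₁) x∈C₀))

      C₀⊆C₁ : C₀ ⊆ C₁
      C₀⊆C₁ x∈C₀ = x∈p∧x≢y⇒x∈p-y (C₀⊆A x∈C₀) (x∈p-y⇒x≢y (A - m₁) x∈C₀)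

      attach-m₁ : ∀ {x} → x ∈ C₁ → x ∉ C₀ → ∃ λ p → p ∈ C₀ × Edge G x p
      attach-m₁ x∈C₁ x∉C₀
        with x∈p∧x∉p-y⇒x≡y (p─q⊆p A ⁅ m₂ ⁆ x∈C₁)
                            (λ x∈A-m₁ → x∉C₀ (x∈p∧x≢y⇒x∈p-y x∈A-m₁ (x∈p-y⇒x≢y A x∈C₁)))
      ... | refl = u₁ , x∈p∧x≢y⇒x∈p-y (x∈p∧x≢y⇒x∈p-y (m₁⇒u₁ (p─q⊆p A ⁅ m₂ ⁆ x∈C₁)) (edge⇒≢ u₁m₁))
                                      (adjacent≢anti vu₁ anti₂) , edge-sym G-sym u₁m₁

      C₁-conn : IsConnected G C₁
      C₁-conn = connected-by-attachment G-sym attach-m₁ C₀-conn C₀⊆C₁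

      attach-m₂ : ∀ {x} → x ∈ A → x ∉ C₁ → ∃ λ p → p ∈ C₁ × Edge G x p
      attach-m₂ x∈A x∉C₁ with x∈p∧x∉p-y⇒x≡y x∈A x∉C₁
      ... | refl = q , x∈p∧x≢y⇒x∈p-y (m₂⇒q x∈A) (edge⇒≢ qm₂) , edge-sym G-sym qm₂

      anti : ∃ (AntiNeighbour A)
      anti = [ (λ m₁∈A → m₁ , m₁∈A , anti₁) , (λ m₂∈A → m₂ , m₂∈A , anti₂) ]′ m₁∨m₂

    -- Case u₁ – m₁ and m₂ adjacent to u₁ or m₁: A ↦ A ∪ {u₁, m₁}, plus m₂ exactly when u₁ ∉ A.
    loss<gain-one-branch : ∀ {u₁ m₁ q m₂} → Edge G v u₁ → Edge G u₁ m₁ → q ≡ u₁ ⊎ q ≡ m₁ → Edge G q m₂ →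
      Edge (complement G) v m₁ → Edge (complement G) v m₂ → m₁ ≢ m₂ → ∑ n (𝟙 ∘ loss?) < ∑ n (𝟙 ∘ gain?)
    loss<gain-one-branch {u₁} {m₁} {q} {m₂} vu₁ u₁m₁ q∈u₁m₁ qm₂ anti₁ anti₂ m₁≢m₂ =
      loss<gain-by-toggles ts image
      where
      c₁ c₂ c₃ : Subset n → Bool
      c₁ X = not (lookup X u₁)
      c₂ X = lookup X m₂
      c₃ _ = true

      ts : List (Fin n × (Subset n → Bool))
      ts = (m₂ , c₁) ∷ (u₁ , c₂) ∷ (m₁ , c₃) ∷ []

      u₁≢m₁ : u₁ ≢ m₁
      u₁≢m₁ = edge⇒≢ u₁m₁
      u₁≢m₂ : u₁ ≢ m₂
      u₁≢m₂ = adjacent≢anti vu₁ anti₂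

      image : ∀ {A} → InClosedNbhd A → Gain (toggles ts A)
      image {A} closed@(v∈A , near) =
        gain-via-attachments vu₁ u₁m₁ qm₂ anti₁ anti₂ v∈ near′ (λ _ → u₁∈) (λ _ → q∈) (inj₁ m₁∈)
        where
        open ≡-Reasoning
        A₁ A₂ : Subset n
        A₁ = toggle m₂ c₁ A
        A₂ = toggle u₁ c₂ A₁
        a : Bool
        a = lookup A u₁

        u₁∈ : u₁ ∈ toggles ts A
        u₁∈ = lookup⇒[]= u₁ _ $ begin
          lookup (toggles ts A) u₁                       ≡⟨ toggle-≢ c₃ A₂ u₁≢m₁ ⟩
          lookup A₂ u₁                                   ≡⟨ toggle-≡ u₁ c₂ A₁ ⟩
          lookup A₁ u₁ xor lookup (A₁ [ u₁ ]≔ false) m₂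
            ≡⟨ cong₂ _xor_ (toggle-≢ c₁ A u₁≢m₂) (lookup∘update′ (u₁≢m₂ ∘ sym) A₁ false) ⟩
          a xor lookup A₁ m₂                             ≡⟨ cong (a xor_) (toggle-≡ m₂ c₁ A) ⟩
          a xor (lookup A m₂ xor not (lookup (A [ m₂ ]≔ false) u₁))
            ≡⟨ cong₂ (λ b c → a xor (b xor not c)) (closed⇒anti∉ closed anti₂) (lookup∘update′ u₁≢m₂ A false) ⟩
          a xor not a                                    ≡⟨ xor-not a ⟩
          true                                           ∎

        m₁∈ : m₁ ∈ toggles ts A
        m₁∈ = lookup⇒[]= m₁ _ $ begin
          lookup (toggles ts A) m₁  ≡⟨ toggle-≡ m₁ c₃ A₂ ⟩
          lookup A₂ m₁ xor true
            ≡⟨ cong (_xor true) (toggles-≢ ((m₂ , c₁) ∷ (u₁ , c₂) ∷ []) A (m₁≢m₂ ∷ (u₁≢m₁ ∘ sym) ∷ [])) ⟩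
          lookup A m₁ xor true      ≡⟨ cong (_xor true) (closed⇒anti∉ closed anti₁) ⟩
          true                      ∎

        q∈ : q ∈ toggles ts A
        q∈ = [ (λ q≡u₁ → subst (_∈ toggles ts A) (sym q≡u₁) u₁∈)
             , (λ q≡m₁ → subst (_∈ toggles ts A) (sym q≡m₁) m₁∈) ]′ q∈u₁m₁

        v∈ : v ∈ toggles ts A
        v∈ = toggles-preserves-∈ ts (anti⇒≢ anti₂ ∷ edge⇒≢ vu₁ ∷ anti⇒≢ anti₁ ∷ []) v∈A

        near′ : ∀ {x} → x ∈ toggles ts A → x ≢ v → x ≢ m₁ → x ≢ m₂ → Edge G v x
        near′ {x} x∈ x≢v x≢m₁ x≢m₂ with x ≟ u₁
        ... | yes refl = vu₁
        ... | no x≢u₁ = near (toggles-reflects-∈ ts (x≢m₂ ∷ x≢u₁ ∷ x≢m₁ ∷ []) x∈) x≢v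

    -- Case m₁, m₂ adjacent to distinct neighbours u₁, u₂ of v: the traces (a, b) of A on (u₁, u₂)
    -- become traces on (m₁, m₂, u₁, u₂) with m₁ = a, m₂ = ¬a, and m₁ ⇒ u₁, m₂ ⇒ u₂.
    loss<gain-two-branches : ∀ {u₁ m₁ u₂ m₂} → Edge G v u₁ → Edge G u₁ m₁ → Edge G v u₂ → Edge G u₂ m₂ → u₁ ≢ u₂ →
      Edge (complement G) v m₁ → Edge (complement G) v m₂ → m₁ ≢ m₂ → ∑ n (𝟙 ∘ loss?) < ∑ n (𝟙 ∘ gain?)
    loss<gain-two-branches {u₁} {m₁} {u₂} {m₂} vu₁ u₁m₁ vu₂ u₂m₂ u₁≢u₂ anti₁ anti₂ m₁≢m₂ =
      loss<gain-by-toggles ts image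
      where
      c₁ c₂ c₃ c₄ : Subset n → Bool
      c₁ X = lookup X u₁
      c₂ X = not (lookup X m₁)
      c₃ X = lookup X m₂ ∧ not (lookup X u₂)
      c₄ X = lookup X m₂ ∧ lookup X u₁

      ts : List (Fin n × (Subset n → Bool))
      ts = (m₁ , c₁) ∷ (m₂ , c₂) ∷ (u₁ , c₃) ∷ (u₂ , c₄) ∷ []

      u₁≢m₁ : u₁ ≢ m₁
      u₁≢m₁ = edge⇒≢ u₁m₁
      u₂≢m₂ : u₂ ≢ m₂
      u₂≢m₂ = edge⇒≢ u₂m₂
      u₁≢m₂ : u₁ ≢ m₂
      u₁≢m₂ = adjacent≢anti vu₁ anti₂
      u₂≢m₁ : u₂ ≢ m₁
      u₂≢m₁ = adjacent≢anti vu₂ anti₁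

      branch₁ : ∀ a b → a ≡ true → a xor (not a ∧ not b) ≡ true
      branch₁ true b refl = refl

      branch₂ : ∀ a b → not a ≡ true → b xor (not a ∧ (a xor (not a ∧ not b))) ≡ true
      branch₂ false true refl = refl
      branch₂ false false refl = refl

      either : ∀ a → a ≡ true ⊎ not a ≡ true
      either true = inj₁ refl
      either false = inj₂ refl

      image : ∀ {A} → InClosedNbhd A → Gain (toggles ts A)
      image {A} closed@(v∈A , near) =
        gain-via-attachments vu₁ u₁m₁ u₂m₂ anti₁ anti₂ v∈ near′ m₁⇒u₁ m₂⇒u₂ m₁∨m₂
        where
        a b : Bool
        a = lookup A u₁
        b = lookup A u₂
        A₁ A₂ A₃ A₄ : Subset n
        A₁ = toggle m₁ c₁ A
        A₂ = toggle m₂ c₂ A₁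
        A₃ = toggle u₁ c₃ A₂
        A₄ = toggle u₂ c₄ A₃

        A₁-m₁ : lookup A₁ m₁ ≡ a
        A₁-m₁ = trans (toggle-≡ m₁ c₁ A)
                      (cong₂ _xor_ (closed⇒anti∉ closed anti₁) (lookup∘update′ u₁≢m₁ A false))

        A₂-m₂ : lookup A₂ m₂ ≡ not a
        A₂-m₂ = trans (toggle-≡ m₂ c₂ A₁) (cong₂ (λ x y → x xor not y)
          (trans (toggle-≢ c₁ A (m₁≢m₂ ∘ sym)) (closed⇒anti∉ closed anti₂))
          (trans (lookup∘update′ m₁≢m₂ A₁ false) A₁-m₁))

        A₂-u₁ : lookup A₂ u₁ ≡ a
        A₂-u₁ = toggles-≢ ((m₁ , c₁) ∷ (m₂ , c₂) ∷ []) A (u₁≢m₁ ∷ u₁≢m₂ ∷ [])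

        A₃-u₁ : lookup A₃ u₁ ≡ a xor (not a ∧ not b)
        A₃-u₁ = trans (toggle-≡ u₁ c₃ A₂) (cong₂ _xor_ A₂-u₁ (cong₂ (λ x y → x ∧ not y)
          (trans (lookup∘update′ (u₁≢m₂ ∘ sym) A₂ false) A₂-m₂)
          (trans (lookup∘update′ (u₁≢u₂ ∘ sym) A₂ false)
                 (toggles-≢ ((m₁ , c₁) ∷ (m₂ , c₂) ∷ []) A (u₂≢m₁ ∷ u₂≢m₂ ∷ [])))))

        A₄-u₂ : lookup A₄ u₂ ≡ b xor (not a ∧ (a xor (not a ∧ not b)))
        A₄-u₂ = trans (toggle-≡ u₂ c₄ A₃) (cong₂ _xor_
          (toggles-≢ ((m₁ , c₁) ∷ (m₂ , c₂) ∷ (u₁ , c₃) ∷ []) A (u₂≢m₁ ∷ u₂≢m₂ ∷ (u₁≢u₂ ∘ sym) ∷ []))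
          (cong₂ _∧_ (trans (lookup∘update′ (u₂≢m₂ ∘ sym) A₃ false)
                            (trans (toggle-≢ c₃ A₂ (u₁≢m₂ ∘ sym)) A₂-m₂))
                     (trans (lookup∘update′ u₁≢u₂ A₃ false) A₃-u₁)))

        A₄-m₁ : lookup A₄ m₁ ≡ a
        A₄-m₁ = trans (toggles-≢ ((m₂ , c₂) ∷ (u₁ , c₃) ∷ (u₂ , c₄) ∷ []) A₁
                                 (m₁≢m₂ ∷ (u₁≢m₁ ∘ sym) ∷ (u₂≢m₁ ∘ sym) ∷ []))
                      A₁-m₁

        A₄-m₂ : lookup A₄ m₂ ≡ not a
        A₄-m₂ = trans (toggles-≢ ((u₁ , c₃) ∷ (u₂ , c₄) ∷ []) A₂ ((u₁≢m₂ ∘ sym) ∷ (u₂≢m₂ ∘ sym) ∷ []))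
                      A₂-m₂

        A₄-u₁ : lookup A₄ u₁ ≡ a xor (not a ∧ not b)
        A₄-u₁ = trans (toggle-≢ c₄ A₃ u₁≢u₂) A₃-u₁

        m₁⇒u₁ : m₁ ∈ A₄ → u₁ ∈ A₄
        m₁⇒u₁ m₁∈ = lookup⇒[]= u₁ A₄ (trans A₄-u₁ (branch₁ a b (trans (sym A₄-m₁) ([]=⇒lookup m₁∈))))

        m₂⇒u₂ : m₂ ∈ A₄ → u₂ ∈ A₄
        m₂⇒u₂ m₂∈ = lookup⇒[]= u₂ A₄ (trans A₄-u₂ (branch₂ a b (trans (sym A₄-m₂) ([]=⇒lookup m₂∈))))

        m₁∨m₂ : m₁ ∈ A₄ ⊎ m₂ ∈ A₄
        m₁∨m₂ = [ (λ a≡true → inj₁ (lookup⇒[]= m₁ A₄ (trans A₄-m₁ a≡true)))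
                , (λ ¬a≡true → inj₂ (lookup⇒[]= m₂ A₄ (trans A₄-m₂ ¬a≡true))) ]′ (either a)

        v∈ : v ∈ A₄
        v∈ = toggles-preserves-∈ ts (anti⇒≢ anti₁ ∷ anti⇒≢ anti₂
                                     ∷ edge⇒≢ vu₁ ∷ edge⇒≢ vu₂ ∷ []) v∈A

        near′ : ∀ {x} → x ∈ A₄ → x ≢ v → x ≢ m₁ → x ≢ m₂ → Edge G v x
        near′ {x} x∈ x≢v x≢m₁ x≢m₂ with x ≟ u₁ | x ≟ u₂
        ... | yes refl | _ = vu₁
        ... | no _ | yes refl = vu₂
        ... | no x≢u₁ | no x≢u₂ = near (toggles-reflects-∈ ts (x≢m₁ ∷ x≢m₂ ∷ x≢u₁ ∷ x≢u₂ ∷ []) x∈) x≢v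

    edge-out-of-closed-nbhd : Connected G → ∀ (extra : Fin n → Bool) {w} →
      Edge (complement G) v w → ¬ T (extra w) →
      ∃₂ λ q m → (Edge G v q ⊎ T (extra q)) × Edge G q m × Edge (complement G) v m × ¬ T (extra m)
    edge-out-of-closed-nbhd conn extra {w} anti-w ¬extra-w =
      let q , m , q∈U , m∉U , qm = connected⇒leaving-edge conn (in-U (inj₁ refl)) w∉U
      in q , m , near (from-U q∈U) m∉U qm , qm ,
         complement-edge⁺ G (λ vm → m∉U (in-U (inj₂ (inj₁ vm)))) (λ v≡m → m∉U (in-U (inj₁ (sym v≡m)))) ,
         (λ e → m∉U (in-U (inj₂ (inj₂ e))))
      where
      U : Subset n
      U = tabulate λ x → ((x == v) ∨ G v x) ∨ extra x

      in-U : ∀ {x} → x ≡ v ⊎ Edge G v x ⊎ T (extra x) → x ∈ U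
      in-U {x} = ∈-tabulate⁺ ∘ from (T-∨ {(x == v) ∨ G v x})
               ∘ Sum.map₁ (from (T-∨ {x == v}) ∘ Sum.map₁ ≡⇒==) ∘ Sum.assocˡ

      from-U : ∀ {x} → x ∈ U → x ≡ v ⊎ Edge G v x ⊎ T (extra x)
      from-U {x} = Sum.assocʳ ∘ Sum.map₁ (Sum.map₁ ==⇒≡ ∘ to (T-∨ {x == v}))
                 ∘ to (T-∨ {(x == v) ∨ G v x}) ∘ ∈-tabulate⁻

      w∉U : w ∉ U
      w∉U w∈U with from-U w∈U
      ... | inj₁ w≡v = proj₂ (complement-edge⁻ G anti-w) (sym w≡v)
      ... | inj₂ (inj₁ vw) = proj₁ (complement-edge⁻ G anti-w) vw
      ... | inj₂ (inj₂ e) = ¬extra-w e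

      near : ∀ {q m} → q ≡ v ⊎ Edge G v q ⊎ T (extra q) → m ∉ U → Edge G q m → Edge G v q ⊎ T (extra q)
      near (inj₁ refl) m∉U vm = contradiction (in-U (inj₂ (inj₁ vm))) m∉U
      near (inj₂ vq⊎e) _ _ = vq⊎e

    other-anti-neighbour : 2 ≤ degree (complement G) v → ∀ m → ∃ λ w → Edge (complement G) v w × w ≢ m
    other-anti-neighbour deg m with two-witnesses _ deg
    ... | w , w′ , w≢w′ , anti-w , anti-w′ with w ≟ m
    ...   | yes refl = w′ , anti-w′ , w≢w′ ∘ sym
    ...   | no w≢m = w , anti-w , w≢m

    loss<gain : Connected G → 2 ≤ degree (complement G) v → ∑ n (𝟙 ∘ loss?) < ∑ n (𝟙 ∘ gain?)
    loss<gain conn deg with other-anti-neighbour deg v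
    ... | w₀ , anti-w₀ , _ with edge-out-of-closed-nbhd conn (λ _ → false) anti-w₀ (λ ())
    ...   | u₁ , m₁ , inj₁ vu₁ , u₁m₁ , anti₁ , _ with other-anti-neighbour deg m₁
    ...     | w , anti-w , w≢m₁ with edge-out-of-closed-nbhd conn (_== m₁) anti-w (w≢m₁ ∘ ==⇒≡)
    ...       | q , m₂ , q-near , qm₂ , anti₂ , m₂≠m₁ = by-position q-near (q ≟ u₁)
      where
      m₁≢m₂ : m₁ ≢ m₂
      m₁≢m₂ = m₂≠m₁ ∘ ≡⇒== ∘ sym

      by-position : Edge G v q ⊎ T (q == m₁) → Dec (q ≡ u₁) → ∑ n (𝟙 ∘ loss?) < ∑ n (𝟙 ∘ gain?)
      by-position (inj₂ q==m₁) _ = loss<gain-one-branch vu₁ u₁m₁ (inj₂ (==⇒≡ q==m₁)) qm₂ anti₁ anti₂ m₁≢m₂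
      by-position (inj₁ _) (yes q≡u₁) = loss<gain-one-branch vu₁ u₁m₁ (inj₁ q≡u₁) qm₂ anti₁ anti₂ m₁≢m₂
      by-position (inj₁ vq) (no q≢u₁) = loss<gain-two-branches vu₁ u₁m₁ vq qm₂ (q≢u₁ ∘ sym) anti₁ anti₂ m₁≢m₂

-- Vertices of H and K: old a is the vertex a of G, new j the j-th additional vertex of the star;
-- in H, new zero is the centre c and the new (suc i) are its leaves other than u.
module Glued {n : ℕ} (G : Graph n) (v : Fin n) (k : ℕ) where

  open Anchored G v

  K H Kᶜ Hᶜ : Graph (n + suc k)
  K = K-graph G v k
  H = H-graph G v k
  Kᶜ = complement K
  Hᶜ = complement H

  old : Fin n → Fin (n + suc k)
  old a = a ↑ˡ suc k

  new : Fin (suc k) → Fin (n + suc k)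
  new j = n ↑ʳ j

  view : (x : Fin (n + suc k)) → Side x
  view = side {n} {suc k}

  leaf≢centre : ∀ {i} → new (suc i) ≢ new zero
  leaf≢centre eq with ↑ʳ-injective n _ _ eq
  ... | ()

  private
    splitAt-old : ∀ a → splitAt n (old a) ≡ inj₁ a
    splitAt-old a = splitAt-↑ˡ n a (suc k)

    splitAt-new : ∀ j → splitAt n (new j) ≡ inj₂ j
    splitAt-new = splitAt-↑ʳ n (suc k)

  K-old-old : ∀ a b → K (old a) (old b) ≡ G a b
  K-old-old a b rewrite splitAt-old a | splitAt-old b = refl

  K-old-new : ∀ a j → K (old a) (new j) ≡ (a == v)
  K-old-new a j rewrite splitAt-old a | splitAt-new j = refl

  K-new-old : ∀ j b → K (new j) (old b) ≡ (b == v)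
  K-new-old j b rewrite splitAt-old b | splitAt-new j = refl

  K-new-new : ∀ i j → K (new i) (new j) ≡ false
  K-new-new i j rewrite splitAt-new i | splitAt-new j = refl

  H-old-old : ∀ a b → H (old a) (old b) ≡ G a b
  H-old-old a b rewrite splitAt-old a | splitAt-old b = refl

  H-old-centre : ∀ a → H (old a) (new zero) ≡ (a == v)
  H-old-centre a rewrite splitAt-old a | splitAt-new zero = refl

  H-old-leaf : ∀ a i → H (old a) (new (suc i)) ≡ false
  H-old-leaf a i rewrite splitAt-old a | splitAt-new (suc i) = refl

  H-centre-old : ∀ b → H (new zero) (old b) ≡ (b == v)
  H-centre-old b rewrite splitAt-old b | splitAt-new zero = refl

  H-leaf-old : ∀ i b → H (new (suc i)) (old b) ≡ false
  H-leaf-old i b rewrite splitAt-old b | splitAt-new (suc i) = refl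

  H-centre-centre : H (new zero) (new zero) ≡ false
  H-centre-centre rewrite splitAt-new zero = refl

  H-centre-leaf : ∀ i → H (new zero) (new (suc i)) ≡ true
  H-centre-leaf i rewrite splitAt-new zero | splitAt-new (suc i) = refl

  H-leaf-leaf : ∀ i j → H (new (suc i)) (new (suc j)) ≡ false
  H-leaf-leaf i j rewrite splitAt-new (suc i) | splitAt-new (suc j) = refl

  Kᶜ-old-old : ∀ a b → Kᶜ (old a) (old b) ≡ complement G a b
  Kᶜ-old-old a b rewrite K-old-old a b | ↑ˡ-== {m = suc k} a b = refl

  Kᶜ-old-new : ∀ a j → Kᶜ (old a) (new j) ≡ not (a == v)
  Kᶜ-old-new a j rewrite K-old-new a j | ==-≢ (↑ˡ≢↑ʳ a j) = ∧-identityʳ _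

  Kᶜ-new-new : ∀ i j → Kᶜ (new i) (new j) ≡ not (i == j)
  Kᶜ-new-new i j rewrite K-new-new i j | ↑ʳ-== {n = n} i j = refl

  K-sym : Symmetric G → Symmetric K
  K-sym G-sym x y with view x | view y
  ... | left a | left b = trans (K-old-old a b) (trans (G-sym a b) (sym (K-old-old b a)))
  ... | left a | right j = trans (K-old-new a j) (sym (K-new-old j a))
  ... | right j | left b = trans (K-new-old j b) (sym (K-old-new b j))
  ... | right i | right j = trans (K-new-new i j) (sym (K-new-new j i))

  module _ (G-sym : Symmetric G) where

    K-connected : ∀ {A} B → v ∈ A → IsConnected G A → IsConnected K (A ++ B)
    K-connected {A} B v∈A A-conn =
      connected-by-attachment (K-sym G-sym) attach (↑ˡ-connected K-old-old A-conn) A∅⊆AB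
      where
      A∅⊆AB : A ++ ∅ ⊆ A ++ B
      A∅⊆AB {x} x∈ with view x
      ... | left a = ↑ˡ-∈⁺ A (↑ˡ-∈⁻ A x∈)
      ... | right j = contradiction (↑ʳ-∈⁻ A x∈) ∉⊥
      attach : ∀ {x} → x ∈ A ++ B → x ∉ A ++ ∅ → ∃ λ p → p ∈ A ++ ∅ × Edge K x p
      attach {x} x∈S x∉ with view x
      ... | left a = contradiction (↑ˡ-∈⁺ A (↑ˡ-∈⁻ A x∈S)) x∉
      ... | right j = old v , ↑ˡ-∈⁺ A v∈A , subst T (sym (K-new-old j v)) (≡⇒== refl)

    -- Every vertex but old v is adjacent in Kᶜ to a new vertex new ℓ, and old v to old w.
    Kᶜ-connected : ∀ {A B ℓ} → ℓ ∈ B → (v ∈ A → ∃ λ w → w ∈ A × Edge (complement G) v w) →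
      IsConnected Kᶜ (A ++ B)
    Kᶜ-connected {A} {B} {ℓ} ℓ∈B anti = connected-by-attachment Kᶜ-sym attach star (p─q⊆p (A ++ B) ⁅ old v ⁆)
      where
      Kᶜ-sym : Symmetric Kᶜ
      Kᶜ-sym = complement-sym (K-sym G-sym)
      adj : ∀ {x} → x ∈ (A ++ B) - old v → x ≢ new ℓ → Edge Kᶜ x (new ℓ)
      adj {x} x∈ x≢ℓ with view x
      ... | left a = subst T (sym (Kᶜ-old-new a ℓ)) (T-not⁺ (x∈p-y⇒x≢y (A ++ B) x∈ ∘ cong old ∘ ==⇒≡))
      ... | right j = subst T (sym (Kᶜ-new-new j ℓ)) (T-not⁺ (x≢ℓ ∘ cong new ∘ ==⇒≡))
      star : IsConnected Kᶜ ((A ++ B) - old v)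
      star = star-connected Kᶜ-sym (x∈p∧x≢y⇒x∈p-y (↑ʳ-∈⁺ A ℓ∈B) (↑ˡ≢↑ʳ v ℓ ∘ sym)) adj
      attach : ∀ {x} → x ∈ A ++ B → x ∉ (A ++ B) - old v → ∃ λ p → p ∈ (A ++ B) - old v × Edge Kᶜ x p
      attach {x} x∈S x∉ with x ≟ old v
      ... | no x≢v = contradiction (x∈p∧x≢y⇒x∈p-y x∈S x≢v) x∉
      ... | yes refl =
        let w , w∈A , vw = anti (↑ˡ-∈⁻ A x∈S)
        in old w , x∈p∧x≢y⇒x∈p-y (↑ˡ-∈⁺ A w∈A) (proj₂ (complement-edge⁻ G vw) ∘ sym ∘ ↑ˡ-injective _ _ _)
           , subst T (sym (Kᶜ-old-old v w)) vw

  H-leaf-isolated : ∀ {A B i y} → zero ∉ B → suc i ∈ B → y ∈ A ++ B → y ≢ new (suc i) →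
    ¬ IsConnected H (A ++ B)
  H-leaf-isolated {A} {B} {i} centre∉B leaf∈B y∈S y≢leaf =
    isolated⇒disconnected (↑ʳ-∈⁺ A leaf∈B) y∈S y≢leaf no-edge
    where
    no-edge : ∀ {z} → z ∈ A ++ B → ¬ Edge H (new (suc i)) z
    no-edge {z} z∈S with view z
    ... | left b = subst T (H-leaf-old i b)
    ... | right zero = contradiction (↑ʳ-∈⁻ A z∈S) centre∉B
    ... | right (suc j) = subst T (H-leaf-leaf i j)

  Hᶜ-centre-isolated : ∀ {A B y} → zero ∈ B → (∀ {a} → a ∈ A → a ≡ v) → y ∈ A ++ B → y ≢ new zero →
    ¬ IsConnected Hᶜ (A ++ B)
  Hᶜ-centre-isolated {A} {B} centre∈B A⊆v y∈S y≢centre =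
    isolated⇒disconnected (↑ʳ-∈⁺ A centre∈B) y∈S y≢centre no-edge
    where
    no-edge : ∀ {z} → z ∈ A ++ B → ¬ Edge Hᶜ (new zero) z
    no-edge {z} z∈S e with view z
    ... | left b = proj₁ (complement-edge⁻ H e) (subst T (sym (H-centre-old b)) (≡⇒== (A⊆v (↑ˡ-∈⁻ A z∈S))))
    ... | right zero = proj₂ (complement-edge⁻ H e) refl
    ... | right (suc j) = proj₁ (complement-edge⁻ H e) (subst T (sym (H-centre-leaf j)) _)

  H-split : ∀ {A B a ℓ} → v ∉ A → a ∈ A → ℓ ∈ B → ¬ IsConnected H (A ++ B)
  H-split {A} {B} {a} {ℓ} v∉A a∈A ℓ∈B =
    no-crossing⇒disconnected (proper U⊆S (new ℓ , ↑ʳ-∈⁺ ∅ ℓ∈B) (old a , ↑ˡ-∈⁺ A a∈A , ∉⊥ ∘ ↑ˡ-∈⁻ ∅))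
      no-cross
    where
    U⊆S : ∅ ++ B ⊆ A ++ B
    U⊆S {x} x∈U with view x
    ... | left b = contradiction (↑ˡ-∈⁻ ∅ x∈U) ∉⊥
    ... | right j = ↑ʳ-∈⁺ A (↑ʳ-∈⁻ ∅ x∈U)
    no-cross : ∀ {x y} → x ∈ ∅ ++ B → y ∈ A ++ B → y ∉ ∅ ++ B → ¬ Edge H x y
    no-cross {x} {y} x∈U y∈S y∉U with view x | view y
    ... | left b | _ = contradiction (↑ˡ-∈⁻ ∅ x∈U) ∉⊥
    ... | right j | right j′ = contradiction (↑ʳ-∈⁺ ∅ (↑ʳ-∈⁻ A y∈S)) y∉U
    ... | right zero | left b = λ e → v∉A (subst (_∈ A) (==⇒≡ (subst T (H-centre-old b) e)) (↑ˡ-∈⁻ A y∈S))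
    ... | right (suc i) | left b = subst T (H-leaf-old i b)

  -- An edge of H crossing a cut is either an edge of K, or joins the centre to a leaf; in the
  -- latter case old v, adjacent in K to both, lies on one side of the cut.
  H⇒K-connected : ∀ {A B} → v ∈ A → IsConnected H (A ++ B) → IsConnected K (A ++ B)
  H⇒K-connected {A} {B} v∈A c = connected-transfer c λ _ → transfer
    where
    transfer : ∀ {U} → Crossing H (A ++ B) U → Crossing K (A ++ B) U
    transfer {U} (x , y , x∈U , y∈S , y∉U , xy) with view x | view y
    ... | left a | left b = _ , _ , x∈U , y∈S , y∉U , subst T (trans (H-old-old a b) (sym (K-old-old a b))) xy
    ... | left a | right zero = _ , _ , x∈U , y∈S , y∉U , subst T (trans (H-old-centre a) (sym (K-old-new a zero))) xy
    ... | left a | right (suc i) = contradiction (subst T (H-old-leaf a i) xy) λ ()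
    ... | right zero | left b = _ , _ , x∈U , y∈S , y∉U , subst T (trans (H-centre-old b) (sym (K-new-old zero b))) xy
    ... | right (suc i) | left b = contradiction (subst T (H-leaf-old i b) xy) λ ()
    ... | right i | right j with old v ∈? U
    ...   | yes v∈U = old v , new j , v∈U , y∈S , y∉U , subst T (sym (K-old-new v j)) (≡⇒== refl)
    ...   | no v∉U = new i , old v , x∈U , ↑ˡ-∈⁺ A v∈A , v∉U , subst T (sym (K-new-old i v)) (≡⇒== refl)

  module _ {A : Subset n} {B : Subset (suc k)} (only-centre : ∀ {j} → j ∈ B → j ≡ zero) where

    H≡K-on : ∀ {x y} → x ∈ A ++ B → y ∈ A ++ B → H x y ≡ K x y
    H≡K-on {x} {y} x∈S y∈S with view x | view y
    ... | left a | left b = trans (H-old-old a b) (sym (K-old-old a b))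
    ... | left a | right j with only-centre (↑ʳ-∈⁻ A y∈S)
    ...   | refl = trans (H-old-centre a) (sym (K-old-new a zero))
    H≡K-on {x} {y} x∈S y∈S | right i | left b with only-centre (↑ʳ-∈⁻ A x∈S)
    ...   | refl = trans (H-centre-old b) (sym (K-new-old zero b))
    H≡K-on {x} {y} x∈S y∈S | right i | right j with only-centre (↑ʳ-∈⁻ A x∈S) | only-centre (↑ʳ-∈⁻ A y∈S)
    ...   | refl | refl = trans H-centre-centre (sym (K-new-new zero zero))

    H⇒K-without-leaves : IsConnected H (A ++ B) → IsConnected K (A ++ B)
    H⇒K-without-leaves c = connected-mono c λ x∈S y∈S → subst T (H≡K-on x∈S y∈S)

    Hᶜ⇒Kᶜ-without-leaves : IsConnected Hᶜ (A ++ B) → IsConnected Kᶜ (A ++ B)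
    Hᶜ⇒Kᶜ-without-leaves c = connected-mono c λ {x} {y} x∈S y∈S →
      subst T (cong (λ e → not e ∧ not (x == y)) (H≡K-on x∈S y∈S))

  -- For B = b ∷ L (b: the centre of the star in H, L: its other leaves), the amounts by which the
  -- H side of the pointwise inequality may exceed the K side (loss) or falls short of it (gain).
  gain-term loss-term : Subset n → Subset (suc k) → ℕ
  gain-term A (true ∷ L) = 0
  gain-term A (false ∷ L) = 𝟙 (nonempty? L ×-dec gain? A)
  loss-term A (true ∷ L) = 𝟙 (nonempty? L ×-dec loss? A)
  loss-term A (false ∷ L) = 0

  leaf-sets : ℕ
  leaf-sets = ∑ k (𝟙 ∘ nonempty?)

  ∑-leaf-sets : ∀ {P : Set} (p : Dec P) → ∑ k (λ L → 𝟙 (nonempty? L ×-dec p)) ≡ 𝟙 p * leaf-sets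
  ∑-leaf-sets p = begin
    ∑ k (λ L → 𝟙 (nonempty? L ×-dec p))  ≡⟨ ∑-cong {k} (λ L → 𝟙-× (nonempty? L) p) ⟩
    ∑ k (λ L → 𝟙 (nonempty? L) * 𝟙 p)    ≡⟨ ∑-*ʳ {k} (𝟙 ∘ nonempty?) (𝟙 p) ⟩
    leaf-sets * 𝟙 p                      ≡⟨ *-comm leaf-sets (𝟙 p) ⟩
    𝟙 p * leaf-sets                      ∎
    where open ≡-Reasoning

  ∑-gain-term : ∀ A → ∑ (suc k) (gain-term A) ≡ 𝟙 (gain? A) * leaf-sets
  ∑-gain-term A = trans (cong₂ _+_ (∑-zero k) refl) (∑-leaf-sets (gain? A))

  ∑-loss-term : ∀ A → ∑ (suc k) (loss-term A) ≡ 𝟙 (loss? A) * leaf-sets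
  ∑-loss-term A = trans (cong₂ _+_ refl (∑-zero k)) (trans (+-identityʳ _) (∑-leaf-sets (loss? A)))

  module _ (G-sym : Symmetric G) where

    private
      only-centre : ∀ {b} {L : Subset k} → ¬ Nonempty L → ∀ {j} → j ∈ b ∷ L → j ≡ zero
      only-centre _ here = refl
      only-centre L≡∅ (there i∈L) = contradiction (_ , i∈L) L≡∅

      K-or-Kᶜ : ∀ {A B ℓ} → ℓ ∈ B → IsConnected K (A ++ B) ⊎ IsConnected Kᶜ (A ++ B)
      K-or-Kᶜ {A} ℓ∈B with v ∈? A | antiNeighbour? A
      ... | no v∉A | _ = inj₂ (Kᶜ-connected G-sym ℓ∈B λ v∈A → contradiction v∈A v∉A)
      ... | yes _ | yes anti = inj₂ (Kᶜ-connected G-sym ℓ∈B (λ _ → anti))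
      ... | yes v∈A | no no-anti = inj₁ (K-connected G-sym _ v∈A (closed-star G-sym v∈A no-anti))

      K-and-Kᶜ : ∀ {A B ℓ} → ℓ ∈ B → Gain A → IsConnected K (A ++ B) × IsConnected Kᶜ (A ++ B)
      K-and-Kᶜ ℓ∈B (v∈A , A-conn , anti) = K-connected G-sym _ v∈A A-conn , Kᶜ-connected G-sym ℓ∈B λ _ → anti

      1≤conn : ∀ {X : Graph (n + suc k)} {S} m m′ → IsConnected X S → 1 ≤ m + (m′ + conn X S)
      1≤conn {X} {S} m m′ c =
        ≤-trans (≤-reflexive (sym (conn-yes c))) (≤-trans (m≤n+m (conn X S) m′) (m≤n+m _ m))

    pointwise-without-leaves : ∀ A b {L : Subset k} → ¬ Nonempty L →
      conn H (A ++ (b ∷ L)) + conn Hᶜ (A ++ (b ∷ L)) ≤ conn K (A ++ (b ∷ L)) + conn Kᶜ (A ++ (b ∷ L))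
    pointwise-without-leaves A b L≡∅ =
      +-mono-≤ (conn-mono (H⇒K-without-leaves {A} {b ∷ _} (only-centre L≡∅)))
               (conn-mono (Hᶜ⇒Kᶜ-without-leaves {A} {b ∷ _} (only-centre L≡∅)))

    pointwise-with-centre : ∀ A {L : Subset k} {i} → i ∈ L → let S = A ++ (true ∷ L) in
      conn H S + conn Hᶜ S ≤ 𝟙 (loss? A) + (conn K S + conn Kᶜ S)
    pointwise-with-centre A {L} {i} i∈L = by-cases (v ∈? A)
      where
      open ≤-Reasoning
      S : Subset (n + suc k)
      S = A ++ (true ∷ L)

      leaf∈S : new (suc i) ∈ S
      leaf∈S = ↑ʳ-∈⁺ A (there i∈L)

      other? : Dec (∃ λ a → a ∈ A × a ≢ v)
      other? = any? λ a → a ∈? A ×-dec ¬? (a ≟ v)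

      Hᶜ-bound : v ∈ A → Dec (∃ λ a → a ∈ A × a ≢ v) → Dec (∃ (AntiNeighbour A)) →
        conn Hᶜ S ≤ 𝟙 (loss? A) + conn Kᶜ S
      Hᶜ-bound _ (no only-v) _ = ≤-trans (≤-reflexive (conn-no (Hᶜ-centre-isolated here A⊆v leaf∈S leaf≢centre))) z≤n
        where
        A⊆v : ∀ {a} → a ∈ A → a ≡ v
        A⊆v {a} a∈A with a ≟ v
        ... | yes a≡v = a≡v
        ... | no a≢v = contradiction (a , a∈A , a≢v) only-v
      Hᶜ-bound _ (yes _) (yes anti) =
        ≤-trans (𝟙≤1 (connected? Hᶜ S)) (1≤conn 0 (𝟙 (loss? A)) (Kᶜ-connected G-sym (there i∈L) λ _ → anti))
      Hᶜ-bound v∈A (yes other) (no no-anti) rewrite 𝟙-yes (loss? A) (v∈A , other , no-anti) =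
        ≤-trans (𝟙≤1 (connected? Hᶜ S)) (m≤m+n 1 _)

      at-most-one : v ∉ A → conn H S + conn Hᶜ S ≤ 1
      at-most-one v∉A with nonempty? A
      ... | yes (a , a∈A) = 𝟙-exclusive (connected? H S) (connected? Hᶜ S) λ H-conn _ → H-split v∉A a∈A (there i∈L) H-conn
      ... | no A≡∅ = 𝟙-exclusive (connected? H S) (connected? Hᶜ S) λ _ →
            Hᶜ-centre-isolated here (λ a∈A → contradiction (_ , a∈A) A≡∅) leaf∈S leaf≢centre

      by-cases : Dec (v ∈ A) → conn H S + conn Hᶜ S ≤ 𝟙 (loss? A) + (conn K S + conn Kᶜ S)
      by-cases (yes v∈A) = begin
        conn H S + conn Hᶜ S                 ≤⟨ +-mono-≤ (conn-mono (H⇒K-connected v∈A)) (Hᶜ-bound v∈A other? (antiNeighbour? A)) ⟩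
        conn K S + (𝟙 (loss? A) + conn Kᶜ S) ≡⟨ x∙yz≈y∙xz (conn K S) (𝟙 (loss? A)) (conn Kᶜ S) ⟩
        𝟙 (loss? A) + (conn K S + conn Kᶜ S) ∎
      by-cases (no v∉A) =
        ≤-trans (at-most-one v∉A) (1≤conn (𝟙 (loss? A)) _ (Kᶜ-connected G-sym (there i∈L) λ v∈A → contradiction v∈A v∉A))

    pointwise-without-centre : ∀ A {L : Subset k} {i} → i ∈ L → let S = A ++ (false ∷ L) in
      𝟙 (gain? A) + (conn H S + conn Hᶜ S) ≤ conn K S + conn Kᶜ S
    pointwise-without-centre A {L} {i} i∈L = by-cases (any? λ y → y ∈? S ×-dec ¬? (y ≟ new (suc i)))
      where
      open ≤-Reasoning
      S : Subset (n + suc k)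
      S = A ++ (false ∷ L)
      leaf∈S : new (suc i) ∈ S
      leaf∈S = ↑ʳ-∈⁺ A (there i∈L)

      by-cases : Dec (∃ λ y → y ∈ S × y ≢ new (suc i)) →
        𝟙 (gain? A) + (conn H S + conn Hᶜ S) ≤ conn K S + conn Kᶜ S
      by-cases (yes (y , y∈S , y≢leaf)) rewrite conn-no (H-leaf-isolated (λ ()) (there i∈L) y∈S y≢leaf) =
        𝟙-pair (gain? A) (connected? Hᶜ S) (connected? K S) (connected? Kᶜ S)
          (λ gain _ → K-and-Kᶜ (there i∈L) gain) (K-or-Kᶜ (there i∈L))
      by-cases (no alone) = begin
        𝟙 (gain? A) + (conn H S + conn Hᶜ S) ≡⟨ cong (_+ (conn H S + conn Hᶜ S)) (𝟙-no (gain? A) no-gain) ⟩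
        conn H S + conn Hᶜ S                 ≤⟨ +-mono-≤ (𝟙≤1 (connected? H S)) (𝟙≤1 (connected? Hᶜ S)) ⟩
        1 + 1                                ≡⟨ sym (cong₂ _+_ (conn-yes (singleton-connected leaf∈S only-leaf))
                                                              (conn-yes (singleton-connected leaf∈S only-leaf))) ⟩
        conn K S + conn Kᶜ S                 ∎
        where
        no-gain : ¬ Gain A
        no-gain (v∈A , _) = alone (old v , ↑ˡ-∈⁺ A v∈A , ↑ˡ≢↑ʳ v (suc i))
        only-leaf : ∀ {x} → x ∈ S → x ≡ new (suc i)
        only-leaf {x} x∈S with x ≟ new (suc i)
        ... | yes x≡leaf = x≡leaf
        ... | no x≢leaf = contradiction (x , x∈S , x≢leaf) alone

    pointwise : ∀ A B → let S = A ++ B in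
      gain-term A B + (conn H S + conn Hᶜ S) ≤ loss-term A B + (conn K S + conn Kᶜ S)
    pointwise A (true ∷ L) with nonempty? L
    ... | yes (_ , i∈L) = pointwise-with-centre A i∈L
    ... | no L≡∅ = pointwise-without-leaves A true L≡∅
    pointwise A (false ∷ L) with nonempty? L
    ... | yes (_ , i∈L) = pointwise-without-centre A i∈L
    ... | no L≡∅ = pointwise-without-leaves A false L≡∅

    H-side<K-side : Irreflexive G → Connected G → 1 ≤ k → 2 ≤ degree (complement G) v →
      ∑ (n + suc k) (λ S → conn H S + conn Hᶜ S) < ∑ (n + suc k) (λ S → conn K S + conn Kᶜ S)
    H-side<K-side G-irr G-conn k≥1 deg = +-cancelˡ-< gains _ _ $ begin-strict
      gains + ∑ (n + suc k) hH                                     ≡⟨ sym (∑-++-+ n gain-term hH) ⟩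
      ∑ n (λ A → ∑ (suc k) (λ B → gain-term A B + hH (A ++ B)))  ≤⟨ ∑-mono-≤ (λ A → ∑-mono-≤ (pointwise A)) ⟩
      ∑ n (λ A → ∑ (suc k) (λ B → loss-term A B + hK (A ++ B)))  ≡⟨ ∑-++-+ n loss-term hK ⟩
      losses + ∑ (n + suc k) hK                                    <⟨ +-monoˡ-< _ losses<gains ⟩
      gains + ∑ (n + suc k) hK                                     ∎
      where
      open ≤-Reasoning
      hH hK : Subset (n + suc k) → ℕ
      hH S = conn H S + conn Hᶜ S
      hK S = conn K S + conn Kᶜ S
      gains losses : ℕ
      gains = ∑ n (λ A → ∑ (suc k) (gain-term A))
      losses = ∑ n (λ A → ∑ (suc k) (loss-term A))
      instance
        _ : NonZero leaf-sets
        _ = >-nonZero (∑-nonempty-pos k k≥1)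
      losses<gains : losses < gains
      losses<gains = begin-strict
        losses                       ≡⟨ trans (∑-cong ∑-loss-term) (∑-*ʳ (𝟙 ∘ loss?) leaf-sets) ⟩
        ∑ n (𝟙 ∘ loss?) * leaf-sets  <⟨ *-monoˡ-< leaf-sets (Anchored.loss<gain G v G-sym G-irr G-conn deg) ⟩
        ∑ n (𝟙 ∘ gain?) * leaf-sets  ≡⟨ sym (trans (∑-cong ∑-gain-term) (∑-*ʳ (𝟙 ∘ gain?) leaf-sets)) ⟩
        gains                        ∎

lemma5 : (n : ℕ) (G : Graph n) → Symmetric G → Irreflexive G → Connected G →
    (v : Fin n) (k : ℕ) → k ≥ 1 → degree (complement G) v ≥ 2 →
    η (H-graph G v k) + η (complement (H-graph G v k)) < η (K-graph G v k) + η (complement (K-graph G v k))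
lemma5 n G G-sym G-irr G-conn v k k≥1 deg = begin-strict
  η H + η Hᶜ                                      ≡⟨ η+η-as-∑ H Hᶜ ⟩
  ∑ (n + suc k) (λ S → conn H S + conn Hᶜ S)      <⟨ H-side<K-side G-sym G-irr G-conn k≥1 deg ⟩
  ∑ (n + suc k) (λ S → conn K S + conn Kᶜ S)      ≡⟨ sym (η+η-as-∑ K Kᶜ) ⟩
  η K + η Kᶜ                                      ∎
  where
  open ≤-Reasoning
  open Glued G v k
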